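{- Let $M$ be a graded $2$-nilpotent Lie algebra over a finite field $K$ and let $A$ and $C$ be finite substructures of $M$. Then \[\delta_2(\langle A\cup C\rangle)\le\delta_2(A)+\delta_2(C)-\delta_2(A\cap C).\]
   Context: A graded $2$-nilpotent Lie algebra over $K$ is a Lie algebra $M=M_1\oplus M_2$ over $K$ with $[M_1,M_1]\subseteq M_2$ and $[M,M_2]=0$, viewed in a language with the vector space operations, predicates $U_1,U_2$ for $M_1,M_2$, projections onto $M_1,M_2$ and the bracket; substructures are graded subalgebras and $\langle X\rangle$ denotes the generated substructure. For finite $M$: a generating o-system is a homogeneous generating set $X=X_1\cup X_2$ with $X_1\subseteq M_1$ a basis of $M_1$ and $X_2\subseteq M_2$ linearly independent modulo $[\langle X_1\rangle,\langle X_1\rangle]$; $o\text{ - }dim_i(M)=|X_i|$. Let $F$ be the free graded $2$-nilpotent Lie algebra on $|X_1|$ free generators of degree $1$ and $|X_2|$ of degree $2$, $f:F\to M$ the surjective homomorphism mapping the generators onto $X_1$, $X_2$ respectively; $ideal\text{ - }dim_2(M)=\dim(\ker f)$ (note $\ker f\subseteq F_2$). Then $\delta_2(M)=o\text{ - }dim_1(M)+o\text{ - }dim_2(M)-ideal\text{ - }dim_2(M)$. -}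

module Defs where

open import Level using (0ℓ)
open import Data.Nat using (ℕ; zero; suc)
open import Data.Fin using (Fin; zero; suc; _<_)
open import Data.Integer as ℤ using (ℤ; +_)
open import Data.List using (List)
open import Data.List.Membership.Propositional using (_∈_)
open import Data.Product using (Σ; ∃; _×_; _,_; proj₁; proj₂)
open import Data.Sum using (_⊎_)
open import Function using (_∘_)
open import Relation.Nullary using (¬_)
open import Relation.Binary.PropositionalEquality using (_≡_; _≢_)
open import Algebra.Structures using (IsCommutativeRing; IsAbelianGroup)

record FiniteField : Set₁ where
  infixl 6 _+_
  infixl 7 _*_
  field
    K                 : Set
    _+_ _*_           : K → K → K
    -_                : K → K
    0# 1#             : K
    isCommutativeRing : IsCommutativeRing _≡_ _+_ _*_ -_ 0# 1#
    0≢1               : 0# ≢ 1#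
    inverse           : ∀ x → x ≢ 0# → ∃ λ y → x * y ≡ 1#
    elements          : List K
    complete          : ∀ x → x ∈ elements

module LinAlg (𝔽 : FiniteField) {W : Set} (_≈_ : W → W → Set)
              (_⊕_ : W → W → W) (𝟎 : W) (_·_ : FiniteField.K 𝔽 → W → W) where
  open FiniteField 𝔽

  lc : ∀ {n} → (Fin n → K) → (Fin n → W) → W
  lc {zero}  c x = 𝟎
  lc {suc n} c x = (c zero · x zero) ⊕ lc (c ∘ suc) (x ∘ suc)

  LinIndep : ∀ {n} → (Fin n → W) → Set
  LinIndep x = ∀ c → lc c x ≈ 𝟎 → ∀ i → c i ≡ 0#

  Spans : (W → Set) → ∀ {n} → (Fin n → W) → Set
  Spans P x = ∀ w → P w → ∃ λ c → w ≈ lc c x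

  IsBasis : (W → Set) → ∀ {n} → (Fin n → W) → Set
  IsBasis P x = (∀ i → P (x i)) × LinIndep x × Spans P x

record G2NLie (𝔽 : FiniteField) : Set₁ where
  open FiniteField 𝔽
  infixl 6 _⊕_
  infixr 7 _·_
  field
    M       : Set
    _⊕_     : M → M → M
    ⊖_      : M → M
    𝟎       : M
    _·_     : K → M → M
    ⊕-isAbelianGroup : IsAbelianGroup _≡_ _⊕_ 𝟎 ⊖_
    ·-distribˡ : ∀ a x y → a · (x ⊕ y) ≡ a · x ⊕ a · y
    ·-distribʳ : ∀ a b x → (a + b) · x ≡ a · x ⊕ b · x
    ·-assoc    : ∀ a b x → (a * b) · x ≡ a · (b · x)
    ·-identity : ∀ x → 1# · x ≡ x
    -- grading M = M₁ ⊕ M₂: predicates U₁ U₂ and projections π₁ π₂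
    U₁ U₂   : M → Set
    π₁ π₂   : M → M
    π₁-+    : ∀ x y → π₁ (x ⊕ y) ≡ π₁ x ⊕ π₁ y
    π₂-+    : ∀ x y → π₂ (x ⊕ y) ≡ π₂ x ⊕ π₂ y
    π₁-·    : ∀ a x → π₁ (a · x) ≡ a · π₁ x
    π₂-·    : ∀ a x → π₂ (a · x) ≡ a · π₂ x
    π-sum   : ∀ x → π₁ x ⊕ π₂ x ≡ x
    π₁-U₁   : ∀ x → U₁ (π₁ x)
    π₂-U₂   : ∀ x → U₂ (π₂ x)
    U₁-π₁   : ∀ x → U₁ x → π₁ x ≡ x
    U₂-π₂   : ∀ x → U₂ x → π₂ x ≡ x
    U₁-π₂   : ∀ x → U₁ x → π₂ x ≡ 𝟎
    U₂-π₁   : ∀ x → U₂ x → π₁ x ≡ 𝟎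
    ⁅_,_⁆   : M → M → M
    ⁅⁆-+ˡ   : ∀ x y z → ⁅ x ⊕ y , z ⁆ ≡ ⁅ x , z ⁆ ⊕ ⁅ y , z ⁆
    ⁅⁆-+ʳ   : ∀ x y z → ⁅ x , y ⊕ z ⁆ ≡ ⁅ x , y ⁆ ⊕ ⁅ x , z ⁆
    ⁅⁆-·ˡ   : ∀ a x y → ⁅ a · x , y ⁆ ≡ a · ⁅ x , y ⁆
    ⁅⁆-·ʳ   : ∀ a x y → ⁅ x , a · y ⁆ ≡ a · ⁅ x , y ⁆
    ⁅⁆-alt  : ∀ x → ⁅ x , x ⁆ ≡ 𝟎
    jacobi  : ∀ x y z → ⁅ x , ⁅ y , z ⁆ ⁆ ⊕ ⁅ y , ⁅ z , x ⁆ ⁆ ⊕ ⁅ z , ⁅ x , y ⁆ ⁆ ≡ 𝟎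
    ⁅U₁,U₁⁆ : ∀ x y → U₁ x → U₁ y → U₂ ⁅ x , y ⁆
    ⁅M,U₂⁆  : ∀ x y → U₂ y → ⁅ x , y ⁆ ≡ 𝟎

module G2NLieTheory {𝔽 : FiniteField} (L : G2NLie 𝔽) where
  open FiniteField 𝔽
  open G2NLie L
  open LinAlg 𝔽 {M} _≡_ _⊕_ 𝟎 _·_ public

  Pred : Set₁
  Pred = M → Set

  record Substructure (S : Pred) : Set where
    field
      ∈-𝟎 : S 𝟎
      ∈-⊕ : ∀ {x y} → S x → S y → S (x ⊕ y)
      ∈-⊖ : ∀ {x} → S x → S (⊖ x)
      ∈-· : ∀ a {x} → S x → S (a · x)
      ∈-π₁ : ∀ {x} → S x → S (π₁ x)
      ∈-π₂ : ∀ {x} → S x → S (π₂ x)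
      ∈-⁅⁆ : ∀ {x y} → S x → S y → S ⁅ x , y ⁆

  FinitePred : Pred → Set
  FinitePred S = ∃ λ (xs : List M) → ∀ x → (S x → x ∈ xs) × (x ∈ xs → S x)

  _∩_ : Pred → Pred → Pred
  (A ∩ C) x = A x × C x

  _∪_ : Pred → Pred → Pred
  (A ∪ C) x = A x ⊎ C x

  Im : ∀ {n} → (Fin n → M) → Pred
  Im X y = ∃ λ i → X i ≡ y

  data ⟨_⟩ (P : Pred) : Pred where
    g-inc : ∀ {x} → P x → ⟨ P ⟩ x
    g-𝟎   : ⟨ P ⟩ 𝟎
    g-⊕   : ∀ {x y} → ⟨ P ⟩ x → ⟨ P ⟩ y → ⟨ P ⟩ (x ⊕ y)
    g-⊖   : ∀ {x} → ⟨ P ⟩ x → ⟨ P ⟩ (⊖ x)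
    g-·   : ∀ a {x} → ⟨ P ⟩ x → ⟨ P ⟩ (a · x)
    g-π₁  : ∀ {x} → ⟨ P ⟩ x → ⟨ P ⟩ (π₁ x)
    g-π₂  : ∀ {x} → ⟨ P ⟩ x → ⟨ P ⟩ (π₂ x)
    g-⁅⁆  : ∀ {x y} → ⟨ P ⟩ x → ⟨ P ⟩ y → ⟨ P ⟩ ⁅ x , y ⁆

  data Span (P : Pred) : Pred where
    s-inc : ∀ {x} → P x → Span P x
    s-𝟎   : Span P 𝟎
    s-⊕   : ∀ {x y} → Span P x → Span P y → Span P (x ⊕ y)
    s-·   : ∀ a {x} → Span P x → Span P (a · x)

  Br : Pred → Pred → Pred
  Br P Q z = ∃ λ u → ∃ λ v → P u × Q v × z ≡ ⁅ u , v ⁆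

  record OSystem (S : Pred) {n₁ n₂ : ℕ} (X₁ : Fin n₁ → M) (X₂ : Fin n₂ → M) : Set where
    field
      basis₁  : IsBasis (λ x → S x × U₁ x) X₁
      X₂⊆S₂   : ∀ k → S (X₂ k) × U₂ (X₂ k)
      -- X₂ linearly independent modulo [⟨X₁⟩, ⟨X₁⟩]
      indep₂  : ∀ c → Span (Br ⟨ Im X₁ ⟩ ⟨ Im X₁ ⟩) (lc c X₂) → ∀ k → c k ≡ 0#
      gen     : ∀ x → (S x → ⟨ Im X₁ ∪ Im X₂ ⟩ x) × (⟨ Im X₁ ∪ Im X₂ ⟩ x → S x)

  -- degree-2 part F₂ of the free graded 2-nilpotent Lie algebra F on
  -- n degree-1 generators e_i and m degree-2 generators y_k:
  -- F₂ = Λ²(K^n) ⊕ K^m, an element written Σ_{i<j} c i j [e_i,e_j] + Σ_k d k y_k,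
  -- modelled as a pair (c , d) with c i j = 0 unless i < j.
  F₂ : ℕ → ℕ → Set
  F₂ n m = (Fin n → Fin n → K) × (Fin m → K)

  InF₂ : ∀ {n m} → F₂ n m → Set
  InF₂ {n} (c , d) = ∀ (i j : Fin n) → ¬ (i < j) → c i j ≡ 0#

  _≈F_ : ∀ {n m} → F₂ n m → F₂ n m → Set
  (c , d) ≈F (c' , d') = (∀ i j → c i j ≡ c' i j) × (∀ k → d k ≡ d' k)

  _⊕F_ : ∀ {n m} → F₂ n m → F₂ n m → F₂ n m
  (c , d) ⊕F (c' , d') = (λ i j → c i j + c' i j) , (λ k → d k + d' k)

  𝟎F : ∀ {n m} → F₂ n m
  𝟎F = (λ _ _ → 0#) , (λ _ → 0#)

  _·F_ : ∀ {n m} → K → F₂ n m → F₂ n m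
  a ·F (c , d) = (λ i j → a * c i j) , (λ k → a * d k)

  module LinF {n m : ℕ} = LinAlg 𝔽 {F₂ n m} _≈F_ _⊕F_ 𝟎F _·F_

  sumM : ∀ {n} → (Fin n → M) → M
  sumM {zero}  f = 𝟎
  sumM {suc n} f = f zero ⊕ sumM (f ∘ suc)

  -- the homomorphism f : F → M sending e_i ↦ X₁ i, y_k ↦ X₂ k, on F₂
  f₂ : ∀ {n m} → (Fin n → M) → (Fin m → M) → F₂ n m → M
  f₂ X₁ X₂ (c , d) = sumM (λ i → sumM (λ j → c i j · ⁅ X₁ i , X₁ j ⁆)) ⊕ lc d X₂

  -- ker f (which lies in F₂)
  Ker : ∀ {n m} → (Fin n → M) → (Fin m → M) → F₂ n m → Set
  Ker X₁ X₂ v = InF₂ v × f₂ X₁ X₂ v ≡ 𝟎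

  record IsDelta₂ (S : Pred) (d : ℤ) : Set where
    field
      n₁ n₂ k  : ℕ
      X₁       : Fin n₁ → M
      X₂       : Fin n₂ → M
      osys     : OSystem S X₁ X₂
      kerBasis : Fin k → F₂ n₁ n₂
      isKerBasis : LinF.IsBasis (Ker X₁ X₂) kerBasis
      value    : d ≡ (+ n₁ ℤ.+ + n₂) ℤ.- + k

module Submission where

-- For a generating o-system (X₁, X₂) of S with kernel dimension k we have
-- δ₂(S) = n₁ + n₂ - k, where n₁ = dim S₁ and, by the universal property of the
-- free algebra F, dim S₂ = dim F₂ - k = choose₂ n₁ + n₂ - k; so
-- δ₂(S) = dim S₁ + dim S₂ - choose₂ (dim S₁).  Choose a basis XI of (A ∩ C)₁,
-- complete it by P in A₁ and by Q in C₁, and choose b spanning (A ∩ C)₂,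
-- completed by as in A₂ and cs in C₂.  Then XI, P, Q is a basis of ⟨A ∪ C⟩₁,
-- and ⟨A ∪ C⟩₂ is spanned by b, as, cs and the p·q brackets ⁅ P i , Q j ⁆.
-- Since choose₂ (i+p+q) - choose₂ (i+p) - choose₂ (i+q) + choose₂ i = p q,
-- the bracket count is exactly absorbed and the inequality follows.
--
-- Equality in K is not decidable, but K is finite, so the zero test holds
-- under double negation; since the conclusion is a decidable inequality of
-- integers, the whole argument runs in the double-negation monad.

open import Defs
import Level
open import Level using (0ℓ)
open import Data.Bool using (true; false; if_then_else_; T)
open import Data.Unit using (tt)
open import Data.Nat as ℕ using (ℕ; zero; suc; z≤n; s≤s; _<ᵇ_)
import Data.Nat.Properties as ℕ
open import Data.Integer as ℤ using (ℤ)
import Data.Integer.Properties as ℤ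
open import Data.Fin using (Fin; zero; suc; toℕ; punchIn; splitAt; combine; remQuot; _↑ˡ_; _↑ʳ_)
open import Data.Fin.Properties using (any?; splitAt⁻¹-↑ˡ; splitAt⁻¹-↑ʳ; remQuot-combine)
open import Data.Vec.Functional using (_++_; _∷_; insertAt)
open import Data.Vec.Functional.Properties using (lookup-++ˡ; lookup-++ʳ; insertAt-punchIn)
open import Data.List as List using (List; [])
open import Data.List.Membership.Propositional using (_∈_)
open import Data.List.Relation.Unary.Any using (here; there)
open import Data.Product as Product using (Σ; ∃; _×_; _,_; proj₁; proj₂; uncurry)
open import Data.Sum using (inj₁; inj₂)
open import Data.Sum.Properties using ([,]-map)
open import Data.Empty using (⊥-elim)
open import Function using (_∘_)
open import Effect.Monad using (RawMonad)
open import Relation.Nullary using (¬_; Dec; yes; no; ¬?)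
open import Relation.Nullary.Decidable using (decidable-stable; ¬¬-excluded-middle)
open import Relation.Nullary.Negation using (DoubleNegation; ¬¬-Monad)
open import Relation.Binary.PropositionalEquality
  using (_≡_; _≢_; refl; sym; trans; cong; cong₂; subst; subst₂; module ≡-Reasoning)
open import Relation.Binary.Bundles using (Setoid)
import Relation.Binary.Reasoning.Setoid as SetoidReasoning
open import Algebra.Bundles using (CommutativeRing)
open import Algebra.Structures using (IsAbelianGroup)
import Algebra.Properties.Ring as RingProperties
import Data.Nat.Tactic.RingSolver as ℕ-Solver
import Data.Integer.Tactic.RingSolver as ℤ-Solver

open RawMonad (¬¬-Monad {Level.zero}) using (_>>=_; _<$>_; pure)

++-induction : ∀ {m n} (P : Fin (m ℕ.+ n) → Set) →
               (∀ i → P (i ↑ˡ n)) → (∀ j → P (m ↑ʳ j)) → ∀ k → P k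
++-induction {m} P left right k with splitAt m k in eq
... | inj₁ i = subst P (splitAt⁻¹-↑ˡ eq) (left i)
... | inj₂ j = subst P (splitAt⁻¹-↑ʳ eq) (right j)

++-all : ∀ {A : Set} {m n} (P : A → Set) {x : Fin m → A} {y : Fin n → A} →
         (∀ i → P (x i)) → (∀ j → P (y j)) → ∀ k → P ((x ++ y) k)
++-all P {x} {y} x∈P y∈P = ++-induction (λ k → P ((x ++ y) k))
  (λ i → subst P (sym (lookup-++ˡ x y i)) (x∈P i))
  (λ j → subst P (sym (lookup-++ʳ x y j)) (y∈P j))

++-allˡ : ∀ {A : Set} {m n} (P : A → Set) (x : Fin m → A) (y : Fin n → A) →
          (∀ k → P ((x ++ y) k)) → ∀ i → P (x i)
++-allˡ P x y x++y∈P i = subst P (lookup-++ˡ x y i) (x++y∈P (i ↑ˡ _))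

++-allʳ : ∀ {A : Set} {m n} (P : A → Set) (x : Fin m → A) (y : Fin n → A) →
          (∀ k → P ((x ++ y) k)) → ∀ j → P (y j)
++-allʳ P x y x++y∈P j = subst P (lookup-++ʳ x y j) (x++y∈P (_ ↑ʳ j))

¬¬-∀Fin : ∀ {n} {P : Fin n → Set} → (∀ i → DoubleNegation (P i)) → DoubleNegation (∀ i → P i)
¬¬-∀Fin {zero} _ = pure λ ()
¬¬-∀Fin {suc n} {P} h = do
  p₀ ← h zero
  ps ← ¬¬-∀Fin {n} {P ∘ suc} (h ∘ suc)
  pure λ { zero → p₀ ; (suc i) → ps i }

¬¬-∀Listed : ∀ {A : Set} {P : A → Set} (xs : List A) → (∀ x → x ∈ xs) →
             (∀ x → DoubleNegation (P x)) → DoubleNegation (∀ x → P x)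
¬¬-∀Listed {A} {P} xs complete h = (λ p x → p x (complete x)) <$> onList xs
  where
  onList : ∀ ys → DoubleNegation (∀ x → x ∈ ys → P x)
  onList [] = pure λ _ ()
  onList (y List.∷ ys) = do
    py ← h y
    pys ← onList ys
    pure λ { x (here refl) → py ; x (there x∈ys) → pys x x∈ys }

module FieldFacts (𝔽 : FiniteField) where
  open FiniteField 𝔽

  ring : CommutativeRing 0ℓ 0ℓ
  ring = record { isCommutativeRing = isCommutativeRing }

  open CommutativeRing ring public
    using (+-assoc; +-comm; +-identityˡ; +-identityʳ; *-assoc; *-comm; *-identityˡ; *-identityʳ;
           distribˡ; distribʳ; zeroˡ; zeroʳ; -‿inverseʳ)
  open RingProperties (CommutativeRing.ring ring) public using (-‿distribˡ-*; -1*x≈-x)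

  eliminate : ∀ a b ι → b * ι ≡ 1# → a + - (a * ι) * b ≡ 0#
  eliminate a b ι bι≡1 = begin
    a + - (a * ι) * b   ≡⟨ cong (a +_) (sym (-‿distribˡ-* _ _)) ⟩
    a + - (a * ι * b)   ≡⟨ cong (λ t → a + - t) (*-assoc _ _ _) ⟩
    a + - (a * (ι * b)) ≡⟨ cong (λ t → a + - (a * t)) (trans (*-comm _ _) bι≡1) ⟩
    a + - (a * 1#)      ≡⟨ cong (λ t → a + - t) (*-identityʳ _) ⟩
    a + - a             ≡⟨ -‿inverseʳ _ ⟩
    0# ∎
    where open ≡-Reasoning

  δ : ∀ {n} → Fin n → Fin n → K
  δ zero zero = 1#
  δ zero (suc j) = 0#
  δ (suc i) zero = 0#
  δ (suc i) (suc j) = δ i j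

  sumK : ∀ {n} → (Fin n → K) → K
  sumK {zero} f = 0#
  sumK {suc n} f = f zero + sumK (f ∘ suc)

  sumK-zero : ∀ {n} (f : Fin n → K) → (∀ i → f i ≡ 0#) → sumK f ≡ 0#
  sumK-zero {zero} f p = refl
  sumK-zero {suc n} f p = trans (cong₂ _+_ (p zero) (sumK-zero (f ∘ suc) (p ∘ suc))) (+-identityʳ _)

-- A vector space over K whose equality is an arbitrary equivalence; it is
-- instantiated with M (propositional equality), K^N and F₂ (pointwise).
record VectorSpace (𝔽 : FiniteField) : Set₁ where
  open FiniteField 𝔽
  infixl 6 _⊕_
  infixr 7 _·_
  infix 4 _≈_
  field
    W          : Set
    _≈_        : W → W → Set
    ≈-refl     : ∀ {x} → x ≈ x
    ≈-sym      : ∀ {x y} → x ≈ y → y ≈ x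
    ≈-trans    : ∀ {x y z} → x ≈ y → y ≈ z → x ≈ z
    _⊕_        : W → W → W
    𝟎          : W
    _·_        : K → W → W
    ⊕-cong     : ∀ {x x' y y'} → x ≈ x' → y ≈ y' → x ⊕ y ≈ x' ⊕ y'
    ·-cong     : ∀ a {x y} → x ≈ y → a · x ≈ a · y
    ⊕-assoc    : ∀ x y z → (x ⊕ y) ⊕ z ≈ x ⊕ (y ⊕ z)
    ⊕-comm     : ∀ x y → x ⊕ y ≈ y ⊕ x
    ⊕-identityˡ : ∀ x → 𝟎 ⊕ x ≈ x
    ·-distribˡ : ∀ a x y → a · (x ⊕ y) ≈ a · x ⊕ a · y
    ·-distribʳ : ∀ a b x → (a + b) · x ≈ a · x ⊕ b · x
    ·-assoc    : ∀ a b x → (a * b) · x ≈ a · (b · x)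
    ·-identity : ∀ x → 1# · x ≈ x
    ·-zeroˡ    : ∀ x → 0# · x ≈ 𝟎

module VectorSpaceTheory {𝔽 : FiniteField} (V : VectorSpace 𝔽) where
  open FiniteField 𝔽
  open FieldFacts 𝔽
  open VectorSpace V public
  open LinAlg 𝔽 {W} _≈_ _⊕_ 𝟎 _·_ public

  setoid : Setoid 0ℓ 0ℓ
  setoid = record { Carrier = W ; _≈_ = _≈_
                  ; isEquivalence = record { refl = ≈-refl ; sym = ≈-sym ; trans = ≈-trans } }
  open SetoidReasoning setoid

  ⊕-identityʳ : ∀ x → x ⊕ 𝟎 ≈ x
  ⊕-identityʳ x = ≈-trans (⊕-comm x 𝟎) (⊕-identityˡ x)

  ⊕-congˡ : ∀ x {y y'} → y ≈ y' → x ⊕ y ≈ x ⊕ y'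
  ⊕-congˡ x p = ⊕-cong ≈-refl p

  ⊕-congʳ : ∀ {x x'} y → x ≈ x' → x ⊕ y ≈ x' ⊕ y
  ⊕-congʳ y p = ⊕-cong p ≈-refl

  ·-congʳ : ∀ {a b} x → a ≡ b → a · x ≈ b · x
  ·-congʳ x refl = ≈-refl

  ⊕-swap : ∀ x y z → x ⊕ (y ⊕ z) ≈ y ⊕ (x ⊕ z)
  ⊕-swap x y z = begin
    x ⊕ (y ⊕ z) ≈⟨ ≈-sym (⊕-assoc x y z) ⟩
    (x ⊕ y) ⊕ z ≈⟨ ⊕-congʳ z (⊕-comm x y) ⟩
    (y ⊕ x) ⊕ z ≈⟨ ⊕-assoc y x z ⟩
    y ⊕ (x ⊕ z) ∎

  ⊕-interchange : ∀ a b c d → (a ⊕ b) ⊕ (c ⊕ d) ≈ (a ⊕ c) ⊕ (b ⊕ d)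
  ⊕-interchange a b c d = begin
    (a ⊕ b) ⊕ (c ⊕ d) ≈⟨ ⊕-assoc a b (c ⊕ d) ⟩
    a ⊕ (b ⊕ (c ⊕ d)) ≈⟨ ⊕-congˡ a (⊕-swap b c d) ⟩
    a ⊕ (c ⊕ (b ⊕ d)) ≈⟨ ≈-sym (⊕-assoc a c (b ⊕ d)) ⟩
    (a ⊕ c) ⊕ (b ⊕ d) ∎

  ·-zeroʳ : ∀ a → a · 𝟎 ≈ 𝟎
  ·-zeroʳ a = begin
    a · 𝟎          ≈⟨ ·-cong a (≈-sym (·-zeroˡ 𝟎)) ⟩
    a · (0# · 𝟎)   ≈⟨ ≈-sym (·-assoc a 0# 𝟎) ⟩
    (a * 0#) · 𝟎   ≈⟨ ·-congʳ 𝟎 (zeroʳ a) ⟩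
    0# · 𝟎         ≈⟨ ·-zeroˡ 𝟎 ⟩
    𝟎 ∎

  ⊖_ : W → W
  ⊖ x = (- 1#) · x

  ⊖-inverseʳ : ∀ x → x ⊕ ⊖ x ≈ 𝟎
  ⊖-inverseʳ x = begin
    x ⊕ (- 1#) · x        ≈⟨ ⊕-congʳ _ (≈-sym (·-identity x)) ⟩
    1# · x ⊕ (- 1#) · x   ≈⟨ ≈-sym (·-distribʳ 1# (- 1#) x) ⟩
    (1# + - 1#) · x       ≈⟨ ·-congʳ x (-‿inverseʳ 1#) ⟩
    0# · x                ≈⟨ ·-zeroˡ x ⟩
    𝟎 ∎

  ⊕≈𝟎⇒≈⊖ : ∀ x y → x ⊕ y ≈ 𝟎 → x ≈ ⊖ y
  ⊕≈𝟎⇒≈⊖ x y p = begin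
    x                ≈⟨ ≈-sym (⊕-identityʳ x) ⟩
    x ⊕ 𝟎            ≈⟨ ⊕-congˡ x (≈-sym (⊖-inverseʳ y)) ⟩
    x ⊕ (y ⊕ ⊖ y)    ≈⟨ ≈-sym (⊕-assoc x y (⊖ y)) ⟩
    (x ⊕ y) ⊕ ⊖ y    ≈⟨ ⊕-congʳ _ p ⟩
    𝟎 ⊕ ⊖ y          ≈⟨ ⊕-identityˡ _ ⟩
    ⊖ y ∎

  lc-cong : ∀ {n} {c d : Fin n → K} {x y : Fin n → W} →
            (∀ i → c i ≡ d i) → (∀ i → x i ≈ y i) → lc c x ≈ lc d y
  lc-cong {zero} p q = ≈-refl
  lc-cong {suc n} {c} {d} {x} p q =
    ⊕-cong (≈-trans (·-congʳ (x zero) (p zero)) (·-cong (d zero) (q zero)))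
           (lc-cong (p ∘ suc) (q ∘ suc))

  lc-zeroˡ : ∀ {n} {c : Fin n → K} (x : Fin n → W) → (∀ i → c i ≡ 0#) → lc c x ≈ 𝟎
  lc-zeroˡ {zero} x p = ≈-refl
  lc-zeroˡ {suc n} x p =
    ≈-trans (⊕-cong (≈-trans (·-congʳ (x zero) (p zero)) (·-zeroˡ _)) (lc-zeroˡ (x ∘ suc) (p ∘ suc)))
            (⊕-identityˡ 𝟎)

  lc-zeroʳ : ∀ {n} (c : Fin n → K) (x : Fin n → W) → (∀ i → x i ≈ 𝟎) → lc c x ≈ 𝟎
  lc-zeroʳ {zero} c x p = ≈-refl
  lc-zeroʳ {suc n} c x p =
    ≈-trans (⊕-cong (≈-trans (·-cong _ (p zero)) (·-zeroʳ _)) (lc-zeroʳ (c ∘ suc) (x ∘ suc) (p ∘ suc)))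
            (⊕-identityˡ 𝟎)

  lc-δ : ∀ {n} (i : Fin n) (x : Fin n → W) → lc (δ i) x ≈ x i
  lc-δ {suc n} zero x =
    ≈-trans (⊕-cong (·-identity _) (lc-zeroˡ (x ∘ suc) (λ _ → refl))) (⊕-identityʳ _)
  lc-δ (suc i) x = ≈-trans (⊕-cong (·-zeroˡ _) (lc-δ i (x ∘ suc))) (⊕-identityˡ _)

  lc-+ : ∀ {n} (c d : Fin n → K) (x : Fin n → W) → lc (λ i → c i + d i) x ≈ lc c x ⊕ lc d x
  lc-+ {zero} c d x = ≈-sym (⊕-identityˡ 𝟎)
  lc-+ {suc n} c d x = begin
    (c zero + d zero) · x zero ⊕ lc (λ i → c (suc i) + d (suc i)) (x ∘ suc)
      ≈⟨ ⊕-cong (·-distribʳ _ _ _) (lc-+ (c ∘ suc) (d ∘ suc) (x ∘ suc)) ⟩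
    (c zero · x zero ⊕ d zero · x zero) ⊕ (lc (c ∘ suc) (x ∘ suc) ⊕ lc (d ∘ suc) (x ∘ suc))
      ≈⟨ ⊕-interchange _ _ _ _ ⟩
    lc c x ⊕ lc d x ∎

  lc-* : ∀ {n} (a : K) (c : Fin n → K) (x : Fin n → W) → lc (λ i → a * c i) x ≈ a · lc c x
  lc-* {zero} a c x = ≈-sym (·-zeroʳ a)
  lc-* {suc n} a c x = begin
    (a * c zero) · x zero ⊕ lc (λ i → a * c (suc i)) (x ∘ suc)
      ≈⟨ ⊕-cong (·-assoc _ _ _) (lc-* a (c ∘ suc) (x ∘ suc)) ⟩
    a · (c zero · x zero) ⊕ a · lc (c ∘ suc) (x ∘ suc)
      ≈⟨ ≈-sym (·-distribˡ _ _ _) ⟩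
    a · lc c x ∎

  lc-++ : ∀ {n m} (c : Fin (n ℕ.+ m) → K) (x : Fin n → W) (y : Fin m → W) →
          lc c (x ++ y) ≈ lc (λ i → c (i ↑ˡ m)) x ⊕ lc (λ j → c (n ↑ʳ j)) y
  lc-++ {zero} c x y = ≈-sym (⊕-identityˡ _)
  lc-++ {suc n} {m} c x y = begin
    c zero · x zero ⊕ lc (c ∘ suc) ((x ++ y) ∘ suc)
      ≈⟨ ⊕-congˡ _ (lc-cong (λ _ → refl) (λ i → ≡⇒≈ ([,]-map (splitAt n i)))) ⟩
    c zero · x zero ⊕ lc (c ∘ suc) ((x ∘ suc) ++ y)
      ≈⟨ ⊕-congˡ _ (lc-++ (c ∘ suc) (x ∘ suc) y) ⟩
    c zero · x zero ⊕ (lc _ (x ∘ suc) ⊕ lc _ y)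
      ≈⟨ ≈-sym (⊕-assoc _ _ _) ⟩
    _ ∎
    where
    ≡⇒≈ : ∀ {u v} → u ≡ v → u ≈ v
    ≡⇒≈ refl = ≈-refl

  lc-++-++ : ∀ {n m} (c : Fin n → K) (d : Fin m → K) (x : Fin n → W) (y : Fin m → W) →
             lc (c ++ d) (x ++ y) ≈ lc c x ⊕ lc d y
  lc-++-++ c d x y =
    ≈-trans (lc-++ (c ++ d) x y)
            (⊕-cong (lc-cong (lookup-++ˡ c d) (λ _ → ≈-refl)) (lc-cong (lookup-++ʳ c d) (λ _ → ≈-refl)))

  lc-insertAt : ∀ {n} (c : Fin n → K) (k : Fin (suc n)) (s : K) (x : Fin (suc n) → W) →
                lc (insertAt c k s) x ≈ s · x k ⊕ lc c (x ∘ punchIn k)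
  lc-insertAt c zero s x = ≈-refl
  lc-insertAt {suc n} c (suc k) s x = begin
    c zero · x zero ⊕ lc (insertAt (c ∘ suc) k s) (x ∘ suc)
      ≈⟨ ⊕-congˡ _ (lc-insertAt (c ∘ suc) k s (x ∘ suc)) ⟩
    c zero · x zero ⊕ (s · x (suc k) ⊕ lc (c ∘ suc) (x ∘ suc ∘ punchIn k))
      ≈⟨ ⊕-swap _ _ _ ⟩
    s · x (suc k) ⊕ lc c (x ∘ punchIn (suc k)) ∎

  lc-shift : ∀ {n} (c t : Fin n → K) (u : Fin n → W) (v : W) →
             lc c (λ i → u i ⊕ t i · v) ≈ lc c u ⊕ sumK (λ i → c i * t i) · v
  lc-shift {zero} c t u v = ≈-sym (≈-trans (⊕-congˡ 𝟎 (·-zeroˡ v)) (⊕-identityˡ 𝟎))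
  lc-shift {suc n} c t u v = begin
    c zero · (u zero ⊕ t zero · v) ⊕ lc (c ∘ suc) (λ i → u (suc i) ⊕ t (suc i) · v)
      ≈⟨ ⊕-cong (≈-trans (·-distribˡ _ _ _) (⊕-congˡ _ (≈-sym (·-assoc _ _ _))))
                (lc-shift (c ∘ suc) (t ∘ suc) (u ∘ suc) v) ⟩
    (c zero · u zero ⊕ (c zero * t zero) · v) ⊕ (lc (c ∘ suc) (u ∘ suc) ⊕ sumK (λ i → c (suc i) * t (suc i)) · v)
      ≈⟨ ⊕-interchange _ _ _ _ ⟩
    lc c u ⊕ ((c zero * t zero) · v ⊕ sumK (λ i → c (suc i) * t (suc i)) · v)
      ≈⟨ ⊕-congˡ _ (≈-sym (·-distribʳ _ _ _)) ⟩
    lc c u ⊕ sumK (λ i → c i * t i) · v ∎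

  InSpan : ∀ {m} → (Fin m → W) → W → Set
  InSpan y w = ∃ λ c → w ≈ lc c y

  module Steinitz (≟0 : ∀ (a : K) → Dec (a ≡ 0#)) where

    empty-span : ∀ {n} (x : Fin (suc n) → W) → LinIndep x → ¬ InSpan {0} (λ ()) (x zero)
    empty-span x x-indep (_ , x₀≈𝟎) = 0≢1 (sym (x-indep (δ zero) (≈-trans (lc-δ zero x) x₀≈𝟎) zero))

    drop-unused : ∀ {m n} (x : Fin n → W) (y : Fin (suc m) → W) (sp : ∀ i → InSpan y (x i)) →
                  (∀ i → proj₁ (sp i) zero ≡ 0#) → ∀ i → InSpan (y ∘ suc) (x i)
    drop-unused x y sp unused i = (a ∘ suc) , (begin
      x i                                   ≈⟨ proj₂ (sp i) ⟩
      a zero · y zero ⊕ lc (a ∘ suc) (y ∘ suc) ≈⟨ ⊕-congʳ _ (≈-trans (·-congʳ _ (unused i)) (·-zeroˡ _)) ⟩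
      𝟎 ⊕ lc (a ∘ suc) (y ∘ suc)            ≈⟨ ⊕-identityˡ _ ⟩
      lc (a ∘ suc) (y ∘ suc) ∎)
      where a = proj₁ (sp i)

    -- If x k uses y₀, subtracting multiples of x k from the other x's removes
    -- y₀ from their combinations and keeps them independent.
    exchange : ∀ {m n} (x : Fin (suc n) → W) (y : Fin (suc m) → W) → LinIndep x →
               (sp : ∀ i → InSpan y (x i)) → ∀ k → proj₁ (sp k) zero ≢ 0# →
               ∃ λ (x' : Fin n → W) → LinIndep x' × (∀ i → InSpan (y ∘ suc) (x' i))
    exchange x y x-indep sp k a₀≢0 = x' , x'-indep , x'-span
      where
      a = λ i → proj₁ (sp i)
      ι = proj₁ (inverse (a k zero) a₀≢0)
      r = λ i → - (a (punchIn k i) zero * ι)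
      x' = λ i → x (punchIn k i) ⊕ r i · x k
      b = λ i j → a (punchIn k i) j + r i * a k j
      x'-span : ∀ i → InSpan (y ∘ suc) (x' i)
      x'-span i = (b i ∘ suc) , (begin
        x (punchIn k i) ⊕ r i · x k                       ≈⟨ ⊕-cong (proj₂ (sp (punchIn k i))) (·-cong _ (proj₂ (sp k))) ⟩
        lc (a (punchIn k i)) y ⊕ r i · lc (a k) y         ≈⟨ ⊕-congˡ _ (≈-sym (lc-* (r i) (a k) y)) ⟩
        lc (a (punchIn k i)) y ⊕ lc (λ j → r i * a k j) y ≈⟨ ≈-sym (lc-+ (a (punchIn k i)) (λ j → r i * a k j) y) ⟩
        lc (b i) y                                        ≈⟨ ⊕-congʳ _ (≈-trans (·-congʳ _ b₀≡0) (·-zeroˡ _)) ⟩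
        𝟎 ⊕ lc (b i ∘ suc) (y ∘ suc)                      ≈⟨ ⊕-identityˡ _ ⟩
        lc (b i ∘ suc) (y ∘ suc) ∎)
        where b₀≡0 = eliminate (a (punchIn k i) zero) (a k zero) ι (proj₂ (inverse (a k zero) a₀≢0))
      x'-indep : LinIndep x'
      x'-indep c lc≈𝟎 i = trans (sym (insertAt-punchIn c k s i)) (x-indep (insertAt c k s) lc-x≈𝟎 (punchIn k i))
        where
        s = sumK (λ i → c i * r i)
        lc-x≈𝟎 : lc (insertAt c k s) x ≈ 𝟎
        lc-x≈𝟎 = begin
          lc (insertAt c k s) x            ≈⟨ lc-insertAt c k s x ⟩
          s · x k ⊕ lc c (x ∘ punchIn k)   ≈⟨ ⊕-comm _ _ ⟩
          lc c (x ∘ punchIn k) ⊕ s · x k   ≈⟨ ≈-sym (lc-shift c r (x ∘ punchIn k) (x k)) ⟩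
          lc c x'                          ≈⟨ lc≈𝟎 ⟩
          𝟎 ∎

    -- Induction on m: drop y₀ if unused, otherwise exchange it against some x k.
    steinitz : ∀ m {n} (x : Fin n → W) (y : Fin m → W) →
               LinIndep x → (∀ i → InSpan y (x i)) → n ℕ.≤ m
    steinitz zero {zero} x y x-indep sp = z≤n
    steinitz zero {suc n} x y x-indep sp = ⊥-elim (empty-span x x-indep (sp zero))
    steinitz (suc m) {n} x y x-indep sp with any? (λ i → ¬? (≟0 (proj₁ (sp i) zero)))
    ... | no none = ℕ.m≤n⇒m≤1+n (steinitz m x (y ∘ suc) x-indep (drop-unused x y sp unused))
      where
      unused : ∀ i → proj₁ (sp i) zero ≡ 0#
      unused i = decidable-stable (≟0 _) (λ a≢0 → none (i , a≢0))
    steinitz (suc m) {suc n} x y x-indep sp | yes (k , a₀≢0) with exchange x y x-indep sp k a₀≢0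
    ... | x' , x'-indep , x'-span = s≤s (steinitz m x' (y ∘ suc) x'-indep x'-span)

    basis-length : ∀ {P : W → Set} {n m} {x : Fin n → W} (z : Fin m → W) → IsBasis P x →
                   (∀ j → P (z j)) → LinIndep z → (∀ w → P w → DoubleNegation (InSpan z w)) → n ≡ m
    basis-length {n = n} {m} {x} z (x∈P , x-indep , x-spans) z∈P z-indep z-spans =
      ℕ.≤-antisym (decidable-stable (n ℕ.≤? m) (steinitz m x z x-indep <$> ¬¬-∀Fin (λ i → z-spans (x i) (x∈P i))))
                (steinitz n z x z-indep (λ j → x-spans (z j) (z∈P j)))

-- Extending an independent family to a basis of a subspace P of bounded
-- dimension.  Whether P is already spanned is not decidable, so the
-- extension exists only under double negation.
module BasisExtension {𝔽 : FiniteField} (V : VectorSpace 𝔽)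
                      (≟0 : ∀ (a : FiniteField.K 𝔽) → Dec (a ≡ FiniteField.0# 𝔽)) where
  open FiniteField 𝔽
  open FieldFacts 𝔽
  open VectorSpaceTheory V
  open SetoidReasoning setoid

  JointlyIndependent : ∀ {n m} → (Fin n → W) → (Fin m → W) → Set
  JointlyIndependent x y = ∀ c d → lc c x ⊕ lc d y ≈ 𝟎 → (∀ i → c i ≡ 0#) × (∀ j → d j ≡ 0#)

  InJointSpan : ∀ {n m} → (Fin n → W) → (Fin m → W) → W → Set
  InJointSpan x y w = ∃ λ c → ∃ λ d → w ≈ lc c x ⊕ lc d y

  jointly⇒independent : ∀ {n m} (x : Fin n → W) (y : Fin m → W) →
                        JointlyIndependent x y → LinIndep (x ++ y)
  jointly⇒independent {n} {m} x y indep e e≈𝟎 =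
    ++-induction (λ k → e k ≡ 0#) (proj₁ zeros) (proj₂ zeros)
    where
    zeros = indep (λ i → e (i ↑ˡ m)) (λ j → e (n ↑ʳ j)) (≈-trans (≈-sym (lc-++ e x y)) e≈𝟎)

  joint⇒span : ∀ {n m} (x : Fin n → W) (y : Fin m → W) w → InJointSpan x y w → InSpan (x ++ y) w
  joint⇒span x y w (c , d , w≈) = c ++ d , ≈-trans w≈ (≈-sym (lc-++-++ c d x y))

  independent-∷ : ∀ {n m} (x : Fin n → W) (y : Fin m → W) (w : W) →
                  JointlyIndependent x y → ¬ InJointSpan x y w → JointlyIndependent x (w ∷ y)
  independent-∷ x y w indep w∉ c d eq with ≟0 (d zero)
  ... | yes d₀≡0 = proj₁ zeros , λ { zero → d₀≡0 ; (suc j) → proj₂ zeros j }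
    where
    zeros = indep c (d ∘ suc) (begin
      lc c x ⊕ lc (d ∘ suc) y                    ≈⟨ ⊕-congʳ _ (≈-sym (⊕-identityʳ _)) ⟩
      (lc c x ⊕ 𝟎) ⊕ lc (d ∘ suc) y              ≈⟨ ⊕-congʳ _ (⊕-congˡ _ (≈-sym (≈-trans (·-congʳ w d₀≡0) (·-zeroˡ w)))) ⟩
      (lc c x ⊕ d zero · w) ⊕ lc (d ∘ suc) y     ≈⟨ ⊕-assoc _ _ _ ⟩
      lc c x ⊕ (d zero · w ⊕ lc (d ∘ suc) y)     ≈⟨ eq ⟩
      𝟎 ∎)
  ... | no d₀≢0 = ⊥-elim (w∉ ((λ i → s * c i) , (λ j → s * d (suc j)) , w≈))
    where
    ι = proj₁ (inverse (d zero) d₀≢0)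
    s = - ι
    R = lc c x ⊕ lc (d ∘ suc) y
    w≈ : w ≈ lc (λ i → s * c i) x ⊕ lc (λ j → s * d (suc j)) y
    w≈ = begin
      w                          ≈⟨ ≈-sym (·-identity w) ⟩
      1# · w                     ≈⟨ ·-congʳ w (trans (sym (proj₂ (inverse (d zero) d₀≢0))) (*-comm _ _)) ⟩
      (ι * d zero) · w           ≈⟨ ·-assoc _ _ _ ⟩
      ι · (d zero · w)           ≈⟨ ·-cong ι (⊕≈𝟎⇒≈⊖ _ _ (≈-trans (⊕-swap _ _ _) eq)) ⟩
      ι · ((- 1#) · R)           ≈⟨ ≈-sym (·-assoc _ _ _) ⟩
      (ι * - 1#) · R             ≈⟨ ·-congʳ R (trans (*-comm _ _) (-1*x≈-x ι)) ⟩
      s · R                      ≈⟨ ·-distribˡ _ _ _ ⟩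
      s · lc c x ⊕ s · lc (d ∘ suc) y
        ≈⟨ ≈-sym (⊕-cong (lc-* s c x) (lc-* s (d ∘ suc) y)) ⟩
      lc (λ i → s * c i) x ⊕ lc (λ j → s * d (suc j)) y ∎

  record Completion (P : W → Set) {n : ℕ} (x : Fin n → W) : Set where
    constructor completion
    field
      {len}  : ℕ
      family : Fin len → W
      inP    : ∀ j → P (family j)
      indep  : JointlyIndependent x family
      spans  : ∀ w → P w → DoubleNegation (InJointSpan x family w)

  -- Each step either stops or adds
  -- a vector, which the bound allows only finitely often.
  extend-to-basis : (P : W → Set) (B : ℕ) →
                    (∀ {r} (h : Fin r → W) → (∀ j → P (h j)) → LinIndep h → r ℕ.≤ B) →
                    ∀ {n} (x : Fin n → W) → (∀ i → P (x i)) → LinIndep x →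
                    DoubleNegation (Completion P x)
  extend-to-basis P B bound {n} x x∈P x-indep =
    grow (suc B) (λ ()) (λ ()) indep₀ (ℕ.≤-trans (ℕ.n<1+n B) (ℕ.m≤n+m (suc B) (n ℕ.+ 0)))
    where
    indep₀ : JointlyIndependent x (λ ())
    indep₀ c d eq = x-indep c (≈-trans (≈-sym (⊕-identityʳ _)) eq) , λ ()
    -- fuel f bounds the remaining steps: B < n + m + f
    grow : ∀ (f : ℕ) {m} (y : Fin m → W) → (∀ j → P (y j)) → JointlyIndependent x y →
           B ℕ.< (n ℕ.+ m) ℕ.+ f → DoubleNegation (Completion P x)
    grow zero {m} y y∈P indep B<n+m _ =
      ℕ.<⇒≱ B<n+m (ℕ.≤-trans (ℕ.≤-reflexive (ℕ.+-identityʳ (n ℕ.+ m)))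
                               (bound (x ++ y) (++-all P x∈P y∈P) (jointly⇒independent x y indep)))
    grow (suc f) {m} y y∈P indep B< = do
      yes spans ← ¬¬-excluded-middle {A = ∀ w → P w → DoubleNegation (InJointSpan x y w)}
        where no ¬spans → do
          (w , w∈P , w∉) ← (λ k → ¬spans (λ w w∈P w∉ → k (w , w∈P , w∉)))
          grow f (w ∷ y) (λ { zero → w∈P ; (suc j) → y∈P j }) (independent-∷ x y w indep w∉)
               (subst (B ℕ.<_) (trans (ℕ.+-suc (n ℕ.+ m) f) (cong (ℕ._+ f) (sym (ℕ.+-suc n m)))) B<)
      pure (completion y y∈P indep spans)

module LieFacts {𝔽 : FiniteField} (L : G2NLie 𝔽) where
  open FiniteField 𝔽
  open FieldFacts 𝔽
  open G2NLie L
  open G2NLieTheory L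
  open ≡-Reasoning
  module AG = IsAbelianGroup ⊕-isAbelianGroup

  ·-zeroˡ : ∀ x → 0# · x ≡ 𝟎
  ·-zeroˡ x = begin
    0# · x                      ≡⟨ sym (AG.identityʳ _) ⟩
    0# · x ⊕ 𝟎                  ≡⟨ cong (0# · x ⊕_) (sym (AG.inverseʳ (0# · x))) ⟩
    0# · x ⊕ (0# · x ⊕ ⊖ (0# · x)) ≡⟨ sym (AG.assoc _ _ _) ⟩
    (0# · x ⊕ 0# · x) ⊕ ⊖ (0# · x) ≡⟨ cong (_⊕ ⊖ (0# · x)) (sym (·-distribʳ 0# 0# x)) ⟩
    (0# + 0#) · x ⊕ ⊖ (0# · x)  ≡⟨ cong (λ a → a · x ⊕ ⊖ (0# · x)) (+-identityˡ 0#) ⟩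
    0# · x ⊕ ⊖ (0# · x)         ≡⟨ AG.inverseʳ _ ⟩
    𝟎 ∎

  vectorSpace : VectorSpace 𝔽
  vectorSpace = record
    { W = M ; _≈_ = _≡_ ; ≈-refl = refl ; ≈-sym = sym ; ≈-trans = trans
    ; _⊕_ = _⊕_ ; 𝟎 = 𝟎 ; _·_ = _·_
    ; ⊕-cong = cong₂ _⊕_ ; ·-cong = λ a → cong (a ·_)
    ; ⊕-assoc = AG.assoc ; ⊕-comm = AG.comm ; ⊕-identityˡ = AG.identityˡ
    ; ·-distribˡ = ·-distribˡ ; ·-distribʳ = ·-distribʳ ; ·-assoc = ·-assoc
    ; ·-identity = ·-identity ; ·-zeroˡ = ·-zeroˡ }

  module Lin = VectorSpaceTheory vectorSpace

  ⊖≡-1· : ∀ x → ⊖ x ≡ (- 1#) · x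
  ⊖≡-1· x = begin
    ⊖ x                          ≡⟨ sym (AG.identityˡ _) ⟩
    𝟎 ⊕ ⊖ x                      ≡⟨ cong (_⊕ ⊖ x) (sym (trans (AG.comm _ _) (Lin.⊖-inverseʳ x))) ⟩
    ((- 1#) · x ⊕ x) ⊕ ⊖ x       ≡⟨ AG.assoc _ _ _ ⟩
    (- 1#) · x ⊕ (x ⊕ ⊖ x)       ≡⟨ cong ((- 1#) · x ⊕_) (AG.inverseʳ x) ⟩
    (- 1#) · x ⊕ 𝟎               ≡⟨ AG.identityʳ _ ⟩
    (- 1#) · x ∎

  deg₁ deg₂ : Pred → Pred
  deg₁ S x = S x × U₁ x
  deg₂ S x = S x × U₂ x

  record IsSubspace (V : Pred) : Set where
    field
      ∈-𝟎 : V 𝟎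
      ∈-⊕ : ∀ {x y} → V x → V y → V (x ⊕ y)
      ∈-· : ∀ a {x} → V x → V (a · x)

    ∈-lc : ∀ {n} (c : Fin n → K) (x : Fin n → M) → (∀ i → V (x i)) → V (lc c x)
    ∈-lc {zero} c x x∈V = ∈-𝟎
    ∈-lc {suc n} c x x∈V = ∈-⊕ (∈-· (c zero) (x∈V zero)) (∈-lc (c ∘ suc) (x ∘ suc) (x∈V ∘ suc))

    ∈-sumM : ∀ {n} (f : Fin n → M) → (∀ i → V (f i)) → V (sumM f)
    ∈-sumM {zero} f f∈V = ∈-𝟎
    ∈-sumM {suc n} f f∈V = ∈-⊕ (f∈V zero) (∈-sumM (f ∘ suc) (f∈V ∘ suc))

  ¬¬Span : ∀ {n} → (Fin n → M) → Pred
  ¬¬Span g w = DoubleNegation (Lin.InSpan g w)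

  ¬¬Span-subspace : ∀ {n} (g : Fin n → M) → IsSubspace (¬¬Span g)
  ¬¬Span-subspace g = record
    { ∈-𝟎 = pure ((λ _ → 0#) , sym (Lin.lc-zeroˡ g (λ _ → refl)))
    ; ∈-⊕ = λ x∈ y∈ → do
        (c , x≡) ← x∈
        (d , y≡) ← y∈
        pure ((λ i → c i + d i) , trans (cong₂ _⊕_ x≡ y≡) (sym (Lin.lc-+ c d g)))
    ; ∈-· = λ a x∈ → do
        (c , x≡) ← x∈
        pure ((λ i → a * c i) , trans (cong (a ·_) x≡) (sym (Lin.lc-* a c g))) }

  ¬¬Span-∋ : ∀ {n} (g : Fin n → M) t → ¬¬Span g (g t)
  ¬¬Span-∋ g t = pure (δ t , sym (Lin.lc-δ t g))

  substructure⇒subspace : ∀ {S} → Substructure S → IsSubspace S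
  substructure⇒subspace S = record { ∈-𝟎 = ∈-𝟎 ; ∈-⊕ = ∈-⊕ ; ∈-· = ∈-· }
    where open Substructure S

  ⟨⟩-substructure : ∀ P → Substructure ⟨ P ⟩
  ⟨⟩-substructure P = record
    { ∈-𝟎 = g-𝟎 ; ∈-⊕ = g-⊕ ; ∈-⊖ = g-⊖ ; ∈-· = g-· ; ∈-π₁ = g-π₁ ; ∈-π₂ = g-π₂ ; ∈-⁅⁆ = g-⁅⁆ }

  π₁-𝟎 : π₁ 𝟎 ≡ 𝟎
  π₁-𝟎 = trans (cong π₁ (sym (·-zeroˡ 𝟎))) (trans (π₁-· 0# 𝟎) (·-zeroˡ _))

  π₂-𝟎 : π₂ 𝟎 ≡ 𝟎
  π₂-𝟎 = trans (cong π₂ (sym (·-zeroˡ 𝟎))) (trans (π₂-· 0# 𝟎) (·-zeroˡ _))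

  π₁-⊖ : ∀ x → π₁ (⊖ x) ≡ (- 1#) · π₁ x
  π₁-⊖ x = trans (cong π₁ (⊖≡-1· x)) (π₁-· _ x)

  π₂-⊖ : ∀ x → π₂ (⊖ x) ≡ (- 1#) · π₂ x
  π₂-⊖ x = trans (cong π₂ (⊖≡-1· x)) (π₂-· _ x)

  U₁-subspace : IsSubspace U₁
  U₁-subspace = record
    { ∈-𝟎 = subst U₁ π₁-𝟎 (π₁-U₁ 𝟎)
    ; ∈-⊕ = λ {x} {y} p q → subst U₁ (trans (π₁-+ x y) (cong₂ _⊕_ (U₁-π₁ x p) (U₁-π₁ y q))) (π₁-U₁ (x ⊕ y))
    ; ∈-· = λ a {x} p → subst U₁ (trans (π₁-· a x) (cong (a ·_) (U₁-π₁ x p))) (π₁-U₁ (a · x)) }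

  U₂-subspace : IsSubspace U₂
  U₂-subspace = record
    { ∈-𝟎 = subst U₂ π₂-𝟎 (π₂-U₂ 𝟎)
    ; ∈-⊕ = λ {x} {y} p q → subst U₂ (trans (π₂-+ x y) (cong₂ _⊕_ (U₂-π₂ x p) (U₂-π₂ y q))) (π₂-U₂ (x ⊕ y))
    ; ∈-· = λ a {x} p → subst U₂ (trans (π₂-· a x) (cong (a ·_) (U₂-π₂ x p))) (π₂-U₂ (a · x)) }

  π₁∘π₁ : ∀ x → π₁ (π₁ x) ≡ π₁ x
  π₁∘π₁ x = U₁-π₁ _ (π₁-U₁ x)

  π₂∘π₂ : ∀ x → π₂ (π₂ x) ≡ π₂ x
  π₂∘π₂ x = U₂-π₂ _ (π₂-U₂ x)

  π₂∘π₁ : ∀ x → π₂ (π₁ x) ≡ 𝟎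
  π₂∘π₁ x = U₁-π₂ _ (π₁-U₁ x)

  π₁∘π₂ : ∀ x → π₁ (π₂ x) ≡ 𝟎
  π₁∘π₂ x = U₂-π₁ _ (π₂-U₂ x)

  ⁅𝟎,_⁆ : ∀ y → ⁅ 𝟎 , y ⁆ ≡ 𝟎
  ⁅𝟎, y ⁆ = trans (cong ⁅_, y ⁆ (sym (·-zeroˡ 𝟎))) (trans (⁅⁆-·ˡ 0# 𝟎 y) (·-zeroˡ _))

  ⁅_,𝟎⁆ : ∀ y → ⁅ y , 𝟎 ⁆ ≡ 𝟎
  ⁅ y ,𝟎⁆ = trans (cong ⁅ y ,_⁆ (sym (·-zeroˡ 𝟎))) (trans (⁅⁆-·ʳ 0# y 𝟎) (·-zeroˡ _))

  antisym : ∀ x y → ⁅ y , x ⁆ ≡ (- 1#) · ⁅ x , y ⁆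
  antisym x y = Lin.⊕≈𝟎⇒≈⊖ ⁅ y , x ⁆ ⁅ x , y ⁆ (begin
    ⁅ y , x ⁆ ⊕ ⁅ x , y ⁆                         ≡⟨ sym (AG.identityˡ _) ⟩
    𝟎 ⊕ (⁅ y , x ⁆ ⊕ ⁅ x , y ⁆)                   ≡⟨ cong (_⊕ (⁅ y , x ⁆ ⊕ ⁅ x , y ⁆)) (sym (⁅⁆-alt y)) ⟩
    ⁅ y , y ⁆ ⊕ (⁅ y , x ⁆ ⊕ ⁅ x , y ⁆)           ≡⟨ sym (AG.assoc _ _ _) ⟩
    (⁅ y , y ⁆ ⊕ ⁅ y , x ⁆) ⊕ ⁅ x , y ⁆           ≡⟨ sym (AG.identityʳ _) ⟩
    ((⁅ y , y ⁆ ⊕ ⁅ y , x ⁆) ⊕ ⁅ x , y ⁆) ⊕ 𝟎     ≡⟨ cong (((⁅ y , y ⁆ ⊕ ⁅ y , x ⁆) ⊕ ⁅ x , y ⁆) ⊕_) (sym (⁅⁆-alt x)) ⟩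
    ((⁅ y , y ⁆ ⊕ ⁅ y , x ⁆) ⊕ ⁅ x , y ⁆) ⊕ ⁅ x , x ⁆ ≡⟨ AG.assoc _ _ _ ⟩
    (⁅ y , y ⁆ ⊕ ⁅ y , x ⁆) ⊕ (⁅ x , y ⁆ ⊕ ⁅ x , x ⁆) ≡⟨ cong₂ _⊕_ (sym (⁅⁆-+ʳ y y x)) (sym (⁅⁆-+ʳ x y x)) ⟩
    ⁅ y , y ⊕ x ⁆ ⊕ ⁅ x , y ⊕ x ⁆                 ≡⟨ sym (⁅⁆-+ˡ y x (y ⊕ x)) ⟩
    ⁅ y ⊕ x , y ⊕ x ⁆                             ≡⟨ ⁅⁆-alt _ ⟩
    𝟎 ∎)

  ⁅U₂,M⁆ : ∀ x y → U₂ x → ⁅ x , y ⁆ ≡ 𝟎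
  ⁅U₂,M⁆ x y x∈U₂ = trans (antisym y x) (trans (cong ((- 1#) ·_) (⁅M,U₂⁆ y x x∈U₂)) (Lin.·-zeroʳ _))

  ⁅⁆-π₁ : ∀ x y → ⁅ x , y ⁆ ≡ ⁅ π₁ x , π₁ y ⁆
  ⁅⁆-π₁ x y = begin
    ⁅ x , y ⁆                                        ≡⟨ cong₂ ⁅_,_⁆ (sym (π-sum x)) (sym (π-sum y)) ⟩
    ⁅ π₁ x ⊕ π₂ x , π₁ y ⊕ π₂ y ⁆                    ≡⟨ ⁅⁆-+ˡ _ _ _ ⟩
    ⁅ π₁ x , π₁ y ⊕ π₂ y ⁆ ⊕ ⁅ π₂ x , π₁ y ⊕ π₂ y ⁆  ≡⟨ cong (⁅ π₁ x , π₁ y ⊕ π₂ y ⁆ ⊕_) (⁅U₂,M⁆ _ _ (π₂-U₂ x)) ⟩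
    ⁅ π₁ x , π₁ y ⊕ π₂ y ⁆ ⊕ 𝟎                       ≡⟨ AG.identityʳ _ ⟩
    ⁅ π₁ x , π₁ y ⊕ π₂ y ⁆                           ≡⟨ ⁅⁆-+ʳ _ _ _ ⟩
    ⁅ π₁ x , π₁ y ⁆ ⊕ ⁅ π₁ x , π₂ y ⁆                ≡⟨ cong (⁅ π₁ x , π₁ y ⁆ ⊕_) (⁅M,U₂⁆ _ _ (π₂-U₂ y)) ⟩
    ⁅ π₁ x , π₁ y ⁆ ⊕ 𝟎                              ≡⟨ AG.identityʳ _ ⟩
    ⁅ π₁ x , π₁ y ⁆ ∎

  ⁅⁆-U₂ : ∀ x y → U₂ ⁅ x , y ⁆
  ⁅⁆-U₂ x y = subst U₂ (sym (⁅⁆-π₁ x y)) (⁅U₁,U₁⁆ _ _ (π₁-U₁ x) (π₁-U₁ y))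

  π₂-⁅⁆ : ∀ x y → π₂ ⁅ x , y ⁆ ≡ ⁅ π₁ x , π₁ y ⁆
  π₂-⁅⁆ x y = trans (U₂-π₂ _ (⁅⁆-U₂ x y)) (⁅⁆-π₁ x y)

  π₁-⁅⁆ : ∀ x y → π₁ ⁅ x , y ⁆ ≡ 𝟎
  π₁-⁅⁆ x y = U₂-π₁ _ (⁅⁆-U₂ x y)

  ⁅⁆-lcˡ : ∀ {n} (c : Fin n → K) (x : Fin n → M) y → ⁅ lc c x , y ⁆ ≡ lc c (λ i → ⁅ x i , y ⁆)
  ⁅⁆-lcˡ {zero} c x y = ⁅𝟎, y ⁆
  ⁅⁆-lcˡ {suc n} c x y = trans (⁅⁆-+ˡ _ _ _) (cong₂ _⊕_ (⁅⁆-·ˡ _ _ _) (⁅⁆-lcˡ (c ∘ suc) (x ∘ suc) y))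

  ⁅⁆-lcʳ : ∀ {n} (c : Fin n → K) (x : Fin n → M) y → ⁅ y , lc c x ⁆ ≡ lc c (λ i → ⁅ y , x i ⁆)
  ⁅⁆-lcʳ {zero} c x y = ⁅ y ,𝟎⁆
  ⁅⁆-lcʳ {suc n} c x y = trans (⁅⁆-+ʳ _ _ _) (cong₂ _⊕_ (⁅⁆-·ʳ _ _ _) (⁅⁆-lcʳ (c ∘ suc) (x ∘ suc) y))

  sumM-cong : ∀ {n} {f g : Fin n → M} → (∀ i → f i ≡ g i) → sumM f ≡ sumM g
  sumM-cong {zero} p = refl
  sumM-cong {suc n} p = cong₂ _⊕_ (p zero) (sumM-cong (p ∘ suc))

  sumM-⊕ : ∀ {n} (f g : Fin n → M) → sumM (λ i → f i ⊕ g i) ≡ sumM f ⊕ sumM g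
  sumM-⊕ {zero} f g = sym (AG.identityˡ 𝟎)
  sumM-⊕ {suc n} f g = trans (cong (f zero ⊕ g zero ⊕_) (sumM-⊕ (f ∘ suc) (g ∘ suc))) (Lin.⊕-interchange _ _ _ _)

  sumM-· : ∀ {n} a (f : Fin n → M) → sumM (λ i → a · f i) ≡ a · sumM f
  sumM-· {zero} a f = sym (Lin.·-zeroʳ a)
  sumM-· {suc n} a f = trans (cong (a · f zero ⊕_) (sumM-· a (f ∘ suc))) (sym (·-distribˡ _ _ _))

  sumM-𝟎 : ∀ {n} (f : Fin n → M) → (∀ i → f i ≡ 𝟎) → sumM f ≡ 𝟎
  sumM-𝟎 {zero} f p = refl
  sumM-𝟎 {suc n} f p = trans (cong₂ _⊕_ (p zero) (sumM-𝟎 (f ∘ suc) (p ∘ suc))) (AG.identityˡ 𝟎)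

  lc≡sumM : ∀ {n} (c : Fin n → K) (x : Fin n → M) → lc c x ≡ sumM (λ i → c i · x i)
  lc≡sumM {zero} c x = refl
  lc≡sumM {suc n} c x = cong (c zero · x zero ⊕_) (lc≡sumM (c ∘ suc) (x ∘ suc))

  ⁅lc,lc⁆ : ∀ {n} (c d : Fin n → K) (X : Fin n → M) →
            ⁅ lc c X , lc d X ⁆ ≡ sumM (λ i → sumM (λ j → (c i * d j) · ⁅ X i , X j ⁆))
  ⁅lc,lc⁆ c d X = begin
    ⁅ lc c X , lc d X ⁆                     ≡⟨ ⁅⁆-lcˡ c X (lc d X) ⟩
    lc c (λ i → ⁅ X i , lc d X ⁆)           ≡⟨ lc≡sumM c _ ⟩
    sumM (λ i → c i · ⁅ X i , lc d X ⁆)     ≡⟨ sumM-cong (λ i → row i) ⟩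
    sumM (λ i → sumM (λ j → (c i * d j) · ⁅ X i , X j ⁆)) ∎
    where
    row : ∀ i → c i · ⁅ X i , lc d X ⁆ ≡ sumM (λ j → (c i * d j) · ⁅ X i , X j ⁆)
    row i = begin
      c i · ⁅ X i , lc d X ⁆                      ≡⟨ cong (c i ·_) (⁅⁆-lcʳ d X (X i)) ⟩
      c i · lc d (λ j → ⁅ X i , X j ⁆)            ≡⟨ sym (Lin.lc-* (c i) d _) ⟩
      lc (λ j → c i * d j) (λ j → ⁅ X i , X j ⁆)  ≡⟨ lc≡sumM (λ j → c i * d j) _ ⟩
      sumM (λ j → (c i * d j) · ⁅ X i , X j ⁆) ∎

  ⁅lc,lc⁆-∈ : ∀ {V} → IsSubspace V → ∀ {n m} (c : Fin n → K) (x : Fin n → M) (d : Fin m → K) (y : Fin m → M) →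
              (∀ i j → V ⁅ x i , y j ⁆) → V ⁅ lc c x , lc d y ⁆
  ⁅lc,lc⁆-∈ {V} V-sub c x d y ⁅x,y⁆∈V =
    subst V (sym (⁅⁆-lcˡ c x (lc d y)))
      (∈-lc c _ (λ i → subst V (sym (⁅⁆-lcʳ d y (x i))) (∈-lc d _ (⁅x,y⁆∈V i))))
    where open IsSubspace V-sub

module FreeDegreeTwo {𝔽 : FiniteField} (L : G2NLie 𝔽) where
  open FiniteField 𝔽
  open FieldFacts 𝔽
  open G2NLie L
  open G2NLieTheory L
  open LieFacts L
  open ≡-Reasoning

  -- Antisymmetrisation of a coefficient matrix: its strictly upper part
  -- E i j - E j i, which is an element of F₂ with the same value under any
  -- alternating bilinear pairing B.
  upper : ∀ {n} → (Fin n → Fin n → K) → Fin n → Fin n → K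
  upper E i j = if toℕ i <ᵇ toℕ j then E i j + - E j i else 0#

  upper-InF₂ : ∀ {n m} (E : Fin n → Fin n → K) (d : Fin m → K) → InF₂ (upper E , d)
  upper-InF₂ E d i j i≮j with toℕ i <ᵇ toℕ j in i<ᵇj
  ... | true = ⊥-elim (i≮j (ℕ.<ᵇ⇒< (toℕ i) (toℕ j) (subst T (sym i<ᵇj) tt)))
  ... | false = refl

  ΣΣ : ∀ {n} → (Fin n → Fin n → K) → (Fin n → Fin n → M) → M
  ΣΣ E B = sumM (λ i → sumM (λ j → E i j · B i j))

  ΣΣ-upper : ∀ {n} (E : Fin n → Fin n → K) (B : Fin n → Fin n → M) →
             (∀ i → B i i ≡ 𝟎) → (∀ i j → B j i ≡ (- 1#) · B i j) → ΣΣ E B ≡ ΣΣ (upper E) B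
  ΣΣ-upper {zero} E B _ _ = refl
  ΣΣ-upper {suc n} E B B-diag B-anti = trans lhs (sym rhs)
    where
    E' = λ i j → E (suc i) (suc j)
    B' = λ i j → B (suc i) (suc j)
    row₀ = sumM (λ j → E zero (suc j) · B zero (suc j))
    col₀ = sumM (λ i → (- E (suc i) zero) · B zero (suc i))
    rest = ΣΣ (upper E') B'
    col₀-flip : sumM (λ i → E (suc i) zero · B (suc i) zero) ≡ col₀
    col₀-flip = sumM-cong {n} (λ i → begin
      E (suc i) zero · B (suc i) zero               ≡⟨ cong (E (suc i) zero ·_) (B-anti zero (suc i)) ⟩
      E (suc i) zero · ((- 1#) · B zero (suc i))    ≡⟨ sym (·-assoc _ _ _) ⟩
      (E (suc i) zero * (- 1#)) · B zero (suc i)    ≡⟨ cong (_· B zero (suc i)) (trans (*-comm _ _) (-1*x≈-x _)) ⟩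
      (- E (suc i) zero) · B zero (suc i) ∎)
    lhs : ΣΣ E B ≡ row₀ ⊕ (col₀ ⊕ rest)
    lhs = begin
      (E zero zero · B zero zero ⊕ row₀) ⊕ sumM (λ i → E (suc i) zero · B (suc i) zero ⊕ sumM (λ j → E' i j · B' i j))
        ≡⟨ cong₂ _⊕_ (cong (_⊕ row₀) (trans (cong (E zero zero ·_) (B-diag zero)) (Lin.·-zeroʳ _))) (sumM-⊕ {n} _ _) ⟩
      (𝟎 ⊕ row₀) ⊕ (sumM (λ i → E (suc i) zero · B (suc i) zero) ⊕ ΣΣ E' B')
        ≡⟨ cong₂ _⊕_ (AG.identityˡ row₀) (cong₂ _⊕_ col₀-flip (ΣΣ-upper E' B' (B-diag ∘ suc) (λ i j → B-anti (suc i) (suc j)))) ⟩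
      row₀ ⊕ (col₀ ⊕ rest) ∎
    rhs : ΣΣ (upper E) B ≡ row₀ ⊕ (col₀ ⊕ rest)
    rhs = begin
      (0# · B zero zero ⊕ sumM (λ j → (E zero (suc j) + - E (suc j) zero) · B zero (suc j)))
        ⊕ sumM (λ i → 0# · B (suc i) zero ⊕ sumM (λ j → upper E' i j · B' i j))
        ≡⟨ cong₂ _⊕_ (cong₂ _⊕_ (·-zeroˡ _) (trans (sumM-cong {n} (λ j → ·-distribʳ _ _ _)) (sumM-⊕ {n} _ _)))
                     (sumM-⊕ {n} _ _) ⟩
      (𝟎 ⊕ (row₀ ⊕ col₀)) ⊕ (sumM (λ i → 0# · B (suc i) zero) ⊕ rest)
        ≡⟨ cong₂ _⊕_ (AG.identityˡ _) (trans (cong (_⊕ rest) (sumM-𝟎 {n} _ (λ i → ·-zeroˡ _))) (AG.identityˡ rest)) ⟩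
      (row₀ ⊕ col₀) ⊕ rest ≡⟨ AG.assoc _ _ _ ⟩
      row₀ ⊕ (col₀ ⊕ rest) ∎

  module _ {n m : ℕ} where
    InF₂-𝟎 : InF₂ {n} {m} 𝟎F
    InF₂-𝟎 i j _ = refl

    InF₂-⊕ : ∀ {v w : F₂ n m} → InF₂ v → InF₂ w → InF₂ (v ⊕F w)
    InF₂-⊕ p q i j i≮j = trans (cong₂ _+_ (p i j i≮j) (q i j i≮j)) (+-identityˡ 0#)

    InF₂-· : ∀ a {v : F₂ n m} → InF₂ v → InF₂ (a ·F v)
    InF₂-· a p i j i≮j = trans (cong (a *_) (p i j i≮j)) (zeroʳ a)

    InF₂-lc : ∀ {r} (c : Fin r → K) (vs : Fin r → F₂ n m) → (∀ t → InF₂ (vs t)) → InF₂ (LinF.lc c vs)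
    InF₂-lc {zero} c vs p = InF₂-𝟎
    InF₂-lc {suc r} c vs p =
      InF₂-⊕ {v = c zero ·F vs zero} {LinF.lc (c ∘ suc) (vs ∘ suc)} (InF₂-· (c zero) {vs zero} (p zero)) (InF₂-lc (c ∘ suc) (vs ∘ suc) (p ∘ suc))

  module _ {n m : ℕ} (X₁ : Fin n → M) (X₂ : Fin m → M) where
    private
      B : Fin n → Fin n → M
      B i j = ⁅ X₁ i , X₁ j ⁆

    f₂-cong : ∀ {v w} → v ≈F w → f₂ X₁ X₂ v ≡ f₂ X₁ X₂ w
    f₂-cong (p , q) =
      cong₂ _⊕_ (sumM-cong {n} (λ i → sumM-cong {n} (λ j → cong (_· B i j) (p i j)))) (Lin.lc-cong q (λ _ → refl))

    f₂-𝟎 : f₂ X₁ X₂ 𝟎F ≡ 𝟎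
    f₂-𝟎 = trans (cong₂ _⊕_ (sumM-𝟎 {n} _ (λ i → sumM-𝟎 {n} _ (λ j → ·-zeroˡ _))) (Lin.lc-zeroˡ X₂ (λ _ → refl)))
                 (AG.identityˡ 𝟎)

    f₂-⊕ : ∀ v w → f₂ X₁ X₂ (v ⊕F w) ≡ f₂ X₁ X₂ v ⊕ f₂ X₁ X₂ w
    f₂-⊕ (c , d) (c' , d') = trans (cong₂ _⊕_ ΣΣ-+ (Lin.lc-+ d d' X₂)) (Lin.⊕-interchange _ _ _ _)
      where
      ΣΣ-+ : ΣΣ (λ i j → c i j + c' i j) B ≡ ΣΣ c B ⊕ ΣΣ c' B
      ΣΣ-+ = trans (sumM-cong {n} (λ i → trans (sumM-cong {n} (λ j → ·-distribʳ _ _ _)) (sumM-⊕ {n} _ _)))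
                   (sumM-⊕ {n} _ _)

    f₂-· : ∀ a v → f₂ X₁ X₂ (a ·F v) ≡ a · f₂ X₁ X₂ v
    f₂-· a (c , d) = trans (cong₂ _⊕_ ΣΣ-* (Lin.lc-* a d X₂)) (sym (·-distribˡ _ _ _))
      where
      ΣΣ-* : ΣΣ (λ i j → a * c i j) B ≡ a · ΣΣ c B
      ΣΣ-* = trans (sumM-cong {n} (λ i → trans (sumM-cong {n} (λ j → ·-assoc _ _ _)) (sumM-· {n} _ _)))
                   (sumM-· {n} _ _)

    f₂-lc : ∀ {r} (c : Fin r → K) (vs : Fin r → F₂ n m) → f₂ X₁ X₂ (LinF.lc c vs) ≡ lc c (f₂ X₁ X₂ ∘ vs)
    f₂-lc {zero} c vs = f₂-𝟎
    f₂-lc {suc r} c vs = trans (f₂-⊕ _ _) (cong₂ _⊕_ (f₂-· _ _) (f₂-lc (c ∘ suc) (vs ∘ suc)))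

    f₂-image : (∀ k → U₂ (X₂ k)) → ∀ v → ⟨ Im X₁ ∪ Im X₂ ⟩ (f₂ X₁ X₂ v) × U₂ (f₂ X₁ X₂ v)
    f₂-image X₂∈U₂ (c , d) = in-⟨X⟩ , in-U₂
      where
      module G = IsSubspace (substructure⇒subspace (⟨⟩-substructure (Im X₁ ∪ Im X₂)))
      module U = IsSubspace U₂-subspace
      in-⟨X⟩ = G.∈-⊕ (G.∈-sumM {n} _ (λ i → G.∈-sumM {n} _ (λ j → g-· _ (g-⁅⁆ (g-inc (inj₁ (i , refl))) (g-inc (inj₁ (j , refl)))))))
                     (G.∈-lc d X₂ (λ k → g-inc (inj₂ (k , refl))))
      in-U₂ = U.∈-⊕ (U.∈-sumM {n} _ (λ i → U.∈-sumM {n} _ (λ j → U.∈-· _ (⁅⁆-U₂ _ _)))) (U.∈-lc d X₂ X₂∈U₂)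

    -- Every element z of ⟨X₁ ∪ X₂⟩ has π₁ z in the span of X₁ and π₂ z in the
    -- image of f₂: the universal property of the free algebra, on generators.
    Lifts : Pred
    Lifts z = (∃ λ c → π₁ z ≡ lc c X₁) × (∃ λ v → InF₂ v × π₂ z ≡ f₂ X₁ X₂ v)

    private
      lift-zero₁ : ∀ {z} → π₁ z ≡ 𝟎 → ∃ λ c → π₁ z ≡ lc c X₁
      lift-zero₁ π₁z≡𝟎 = (λ _ → 0#) , trans π₁z≡𝟎 (sym (Lin.lc-zeroˡ X₁ (λ _ → refl)))

      lift-zero₂ : ∀ {z} → π₂ z ≡ 𝟎 → ∃ λ v → InF₂ v × π₂ z ≡ f₂ X₁ X₂ v
      lift-zero₂ π₂z≡𝟎 = 𝟎F , InF₂-𝟎 {n} {m} , trans π₂z≡𝟎 (sym f₂-𝟎)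

      lift-· : ∀ a {x y} → π₁ y ≡ a · π₁ x → π₂ y ≡ a · π₂ x → Lifts x → Lifts y
      lift-· a e₁ e₂ ((c , pc) , (v , iv , pv)) =
        ((λ i → a * c i) , trans e₁ (trans (cong (a ·_) pc) (sym (Lin.lc-* a c X₁)))) ,
        (a ·F v , InF₂-· a {v} iv , trans e₂ (trans (cong (a ·_) pv) (sym (f₂-· a v))))

      -- π₂ ⁅ x , y ⁆ = ⁅ π₁ x , π₁ y ⁆ is an antisymmetrised double sum over X₁.
      lift-⁅⁆ : ∀ {x y} c d → π₁ x ≡ lc c X₁ → π₁ y ≡ lc d X₁ → Lifts ⁅ x , y ⁆
      lift-⁅⁆ {x} {y} c d pc pd = lift-zero₁ (π₁-⁅⁆ x y) , ((upper E , (λ _ → 0#)) , upper-InF₂ {m = m} E (λ _ → 0#) , eq)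
        where
        E = λ i j → c i * d j
        eq : π₂ ⁅ x , y ⁆ ≡ f₂ X₁ X₂ (upper E , (λ _ → 0#))
        eq = begin
          π₂ ⁅ x , y ⁆             ≡⟨ π₂-⁅⁆ x y ⟩
          ⁅ π₁ x , π₁ y ⁆          ≡⟨ cong₂ ⁅_,_⁆ pc pd ⟩
          ⁅ lc c X₁ , lc d X₁ ⁆    ≡⟨ ⁅lc,lc⁆ c d X₁ ⟩
          ΣΣ E B                   ≡⟨ ΣΣ-upper E B (λ i → ⁅⁆-alt _) (λ i j → antisym _ _) ⟩
          ΣΣ (upper E) B           ≡⟨ sym (trans (cong (ΣΣ (upper E) B ⊕_) (Lin.lc-zeroˡ X₂ (λ _ → refl))) (AG.identityʳ _)) ⟩
          f₂ X₁ X₂ (upper E , (λ _ → 0#)) ∎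

    lift : (∀ i → U₁ (X₁ i)) → (∀ k → U₂ (X₂ k)) → ∀ {z} → ⟨ Im X₁ ∪ Im X₂ ⟩ z → Lifts z
    lift X₁∈U₁ X₂∈U₂ (g-inc (inj₁ (i , refl))) =
      (δ i , trans (U₁-π₁ _ (X₁∈U₁ i)) (sym (Lin.lc-δ i X₁))) , lift-zero₂ (U₁-π₂ _ (X₁∈U₁ i))
    lift X₁∈U₁ X₂∈U₂ (g-inc (inj₂ (k , refl))) =
      lift-zero₁ (U₂-π₁ _ (X₂∈U₂ k)) ,
      (((λ _ _ → 0#) , δ k) , (λ _ _ _ → refl) ,
       trans (U₂-π₂ _ (X₂∈U₂ k))
             (sym (trans (cong₂ _⊕_ (sumM-𝟎 {n} _ (λ i → sumM-𝟎 {n} _ (λ j → ·-zeroˡ _))) (Lin.lc-δ k X₂)) (AG.identityˡ _))))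
    lift X₁∈U₁ X₂∈U₂ g-𝟎 = lift-zero₁ π₁-𝟎 , lift-zero₂ π₂-𝟎
    lift X₁∈U₁ X₂∈U₂ (g-⊕ {x} {y} p q) with lift X₁∈U₁ X₂∈U₂ p | lift X₁∈U₁ X₂∈U₂ q
    ... | (c , pc) , (v , iv , pv) | (c' , pc') , (v' , iv' , pv') =
      ((λ i → c i + c' i) , trans (π₁-+ x y) (trans (cong₂ _⊕_ pc pc') (sym (Lin.lc-+ c c' X₁)))) ,
      (v ⊕F v' , InF₂-⊕ {v = v} {v'} iv iv' , trans (π₂-+ x y) (trans (cong₂ _⊕_ pv pv') (sym (f₂-⊕ v v'))))
    lift X₁∈U₁ X₂∈U₂ (g-· a {x} p) = lift-· a (π₁-· a x) (π₂-· a x) (lift X₁∈U₁ X₂∈U₂ p)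
    lift X₁∈U₁ X₂∈U₂ (g-⊖ {x} p) = lift-· (- 1#) (π₁-⊖ x) (π₂-⊖ x) (lift X₁∈U₁ X₂∈U₂ p)
    lift X₁∈U₁ X₂∈U₂ (g-π₁ {x} p) with lift X₁∈U₁ X₂∈U₂ p
    ... | (c , pc) , _ = (c , trans (π₁∘π₁ x) pc) , lift-zero₂ (π₂∘π₁ x)
    lift X₁∈U₁ X₂∈U₂ (g-π₂ {x} p) with lift X₁∈U₁ X₂∈U₂ p
    ... | _ , (v , iv , pv) = lift-zero₁ (π₁∘π₂ x) , (v , iv , trans (π₂∘π₂ x) pv)
    lift X₁∈U₁ X₂∈U₂ (g-⁅⁆ p q) with lift X₁∈U₁ X₂∈U₂ p | lift X₁∈U₁ X₂∈U₂ q
    ... | (c , pc) , _ | (d , pd) , _ = lift-⁅⁆ c d pc pd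

-- choose₂ n = n(n-1)/2 is the number of pairs i < j in Fin n, i.e. dim Λ²(Kⁿ).
choose₂ : ℕ → ℕ
choose₂ zero = 0
choose₂ (suc n) = n ℕ.+ choose₂ n

pair : ∀ n → Fin (choose₂ n) → Fin n × Fin n
pair (suc n) = (λ j → zero , suc j) ++ (Product.map suc suc ∘ pair n)

-- Coordinates: F₂ n m ≅ K^(choose₂ n + m), where F₂ n m is the degree-2 part of the
-- free algebra on n + m generators.  These turn dimension counts in F₂ into
-- counts in K^N, where the standard basis is available.
module Coordinates {𝔽 : FiniteField} (L : G2NLie 𝔽) where
  open FiniteField 𝔽
  open FieldFacts 𝔽
  open G2NLie L
  open G2NLieTheory L

  Kⁿ : ℕ → VectorSpace 𝔽
  Kⁿ N = record
    { W = Fin N → K ; _≈_ = λ u v → ∀ t → u t ≡ v t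
    ; ≈-refl = λ t → refl ; ≈-sym = λ p t → sym (p t) ; ≈-trans = λ p q t → trans (p t) (q t)
    ; _⊕_ = λ u v t → u t + v t ; 𝟎 = λ _ → 0# ; _·_ = λ a u t → a * u t
    ; ⊕-cong = λ p q t → cong₂ _+_ (p t) (q t) ; ·-cong = λ a p t → cong (a *_) (p t)
    ; ⊕-assoc = λ x y z t → +-assoc _ _ _ ; ⊕-comm = λ x y t → +-comm _ _ ; ⊕-identityˡ = λ x t → +-identityˡ _
    ; ·-distribˡ = λ a x y t → distribˡ _ _ _ ; ·-distribʳ = λ a b x t → distribʳ _ _ _
    ; ·-assoc = λ a b x t → *-assoc _ _ _ ; ·-identity = λ x t → *-identityˡ _ ; ·-zeroˡ = λ x t → zeroˡ _ }

  F₂-space : ℕ → ℕ → VectorSpace 𝔽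
  F₂-space n m = record
    { W = F₂ n m ; _≈_ = _≈F_ ; ≈-refl = (λ i j → refl) , (λ k → refl)
    ; ≈-sym = λ p → (λ i j → sym (proj₁ p i j)) , (λ k → sym (proj₂ p k))
    ; ≈-trans = λ p q → (λ i j → trans (proj₁ p i j) (proj₁ q i j)) , (λ k → trans (proj₂ p k) (proj₂ q k))
    ; _⊕_ = _⊕F_ ; 𝟎 = 𝟎F ; _·_ = _·F_
    ; ⊕-cong = λ p q → (λ i j → cong₂ _+_ (proj₁ p i j) (proj₁ q i j)) , (λ k → cong₂ _+_ (proj₂ p k) (proj₂ q k))
    ; ·-cong = λ a p → (λ i j → cong (a *_) (proj₁ p i j)) , (λ k → cong (a *_) (proj₂ p k))
    ; ⊕-assoc = λ x y z → (λ i j → +-assoc _ _ _) , (λ k → +-assoc _ _ _)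
    ; ⊕-comm = λ x y → (λ i j → +-comm _ _) , (λ k → +-comm _ _)
    ; ⊕-identityˡ = λ x → (λ i j → +-identityˡ _) , (λ k → +-identityˡ _)
    ; ·-distribˡ = λ a x y → (λ i j → distribˡ _ _ _) , (λ k → distribˡ _ _ _)
    ; ·-distribʳ = λ a b x → (λ i j → distribʳ _ _ _) , (λ k → distribʳ _ _ _)
    ; ·-assoc = λ a b x → (λ i j → *-assoc _ _ _) , (λ k → *-assoc _ _ _)
    ; ·-identity = λ x → (λ i j → *-identityˡ _) , (λ k → *-identityˡ _)
    ; ·-zeroˡ = λ x → (λ i j → zeroˡ _) , (λ k → zeroˡ _) }

  lc-at : ∀ {N r} (d : Fin r → K) (x : Fin r → Fin N → K) s →
          VectorSpaceTheory.lc (Kⁿ N) d x s ≡ sumK (λ i → d i * x i s)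
  lc-at {r = zero} d x s = refl
  lc-at {r = suc r} d x s = cong (d zero * x zero s +_) (lc-at (d ∘ suc) (x ∘ suc) s)

  sumK-δ : ∀ {N} (c : Fin N → K) s → sumK (λ i → c i * δ i s) ≡ c s
  sumK-δ {suc N} c zero = trans (cong₂ _+_ (*-identityʳ _) (sumK-zero {N} _ (λ i → zeroʳ _))) (+-identityʳ _)
  sumK-δ {suc N} c (suc s) = trans (cong₂ _+_ (zeroʳ _) (sumK-δ (c ∘ suc) s)) (+-identityˡ _)

  lc-δ-Kⁿ : ∀ {N} (c : Fin N → K) s → VectorSpaceTheory.lc (Kⁿ N) c δ s ≡ c s
  lc-δ-Kⁿ c s = trans (lc-at c δ s) (sumK-δ c s)

  fromPairs : ∀ n → (Fin (choose₂ n) → K) → Fin n → Fin n → K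
  fromPairs (suc n) w zero    zero    = 0#
  fromPairs (suc n) w zero    (suc j) = w (j ↑ˡ choose₂ n)
  fromPairs (suc n) w (suc i) zero    = 0#
  fromPairs (suc n) w (suc i) (suc j) = fromPairs n (w ∘ (n ↑ʳ_)) i j

  fromPairs-cong : ∀ n {w w' : Fin (choose₂ n) → K} → (∀ t → w t ≡ w' t) → ∀ i j → fromPairs n w i j ≡ fromPairs n w' i j
  fromPairs-cong (suc n) p zero    zero    = refl
  fromPairs-cong (suc n) p zero    (suc j) = p _
  fromPairs-cong (suc n) p (suc i) zero    = refl
  fromPairs-cong (suc n) p (suc i) (suc j) = fromPairs-cong n (p ∘ (n ↑ʳ_)) i j

  fromPairs-zero : ∀ n (w : Fin (choose₂ n) → K) → (∀ t → w t ≡ 0#) → ∀ i j → fromPairs n w i j ≡ 0#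
  fromPairs-zero (suc n) w p zero    zero    = refl
  fromPairs-zero (suc n) w p zero    (suc j) = p _
  fromPairs-zero (suc n) w p (suc i) zero    = refl
  fromPairs-zero (suc n) w p (suc i) (suc j) = fromPairs-zero n _ (p ∘ (n ↑ʳ_)) i j

  fromPairs-upper : ∀ n (w : Fin (choose₂ n) → K) → ∀ i j → ¬ (i Data.Fin.< j) → fromPairs n w i j ≡ 0#
  fromPairs-upper (suc n) w zero    zero    i≮j = refl
  fromPairs-upper (suc n) w zero    (suc j) i≮j = ⊥-elim (i≮j (s≤s z≤n))
  fromPairs-upper (suc n) w (suc i) zero    i≮j = refl
  fromPairs-upper (suc n) w (suc i) (suc j) i≮j = fromPairs-upper n _ i j (i≮j ∘ s≤s)

  fromPairs-pair : ∀ n (w : Fin (choose₂ n) → K) t → uncurry (fromPairs n w) (pair n t) ≡ w t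
  fromPairs-pair (suc n) w = ++-induction (λ t → uncurry (fromPairs (suc n) w) (pair (suc n) t) ≡ w t)
    (λ j → cong (uncurry (fromPairs (suc n) w)) (lookup-++ˡ _ (Product.map suc suc ∘ pair n) j))
    (λ t → trans (cong (uncurry (fromPairs (suc n) w)) (lookup-++ʳ (λ j → zero , suc j) _ t))
                 (fromPairs-pair n (w ∘ (n ↑ʳ_)) t))

  pair-fromPairs : ∀ n (c : Fin n → Fin n → K) → (∀ i j → ¬ (i Data.Fin.< j) → c i j ≡ 0#) →
                   ∀ i j → fromPairs n (uncurry c ∘ pair n) i j ≡ c i j
  pair-fromPairs (suc n) c c-upper zero    zero    = sym (c-upper zero zero λ ())
  pair-fromPairs (suc n) c c-upper zero    (suc j) = cong (uncurry c) (lookup-++ˡ _ (Product.map suc suc ∘ pair n) j)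
  pair-fromPairs (suc n) c c-upper (suc i) zero    = sym (c-upper (suc i) zero λ ())
  pair-fromPairs (suc n) c c-upper (suc i) (suc j) =
    trans (fromPairs-cong n (λ t → cong (uncurry c) (lookup-++ʳ (λ j → zero , suc j) _ t)) i j)
          (pair-fromPairs n (λ i j → c (suc i) (suc j)) (λ i j i≮j → c-upper (suc i) (suc j) (i≮j ∘ ℕ.≤-pred)) i j)

  module Coord (n m : ℕ) where
    N : ℕ
    N = choose₂ n ℕ.+ m

    module Kᴺ = VectorSpaceTheory (Kⁿ N)
    module F = VectorSpaceTheory (F₂-space n m)

    φ : F₂ n m → Fin N → K
    φ (c , d) = (uncurry c ∘ pair n) ++ d

    ψ : (Fin N → K) → F₂ n m
    ψ w = fromPairs n (w ∘ (_↑ˡ m)) , w ∘ (choose₂ n ↑ʳ_)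

    φψ : ∀ w t → φ (ψ w) t ≡ w t
    φψ w = ++-induction (λ t → φ (ψ w) t ≡ w t)
      (λ s → trans (lookup-++ˡ (uncurry (proj₁ (ψ w)) ∘ pair n) (proj₂ (ψ w)) s) (fromPairs-pair n (w ∘ (_↑ˡ m)) s))
      (λ k → lookup-++ʳ (uncurry (proj₁ (ψ w)) ∘ pair n) (proj₂ (ψ w)) k)

    ψφ : ∀ v → InF₂ v → ψ (φ v) ≈F v
    ψφ (c , d) c-upper =
      (λ i j → trans (fromPairs-cong n (lookup-++ˡ (uncurry c ∘ pair n) d) i j) (pair-fromPairs n c c-upper i j)) ,
      lookup-++ʳ (uncurry c ∘ pair n) d

    ψ-InF₂ : ∀ w → InF₂ (ψ w)
    ψ-InF₂ w = fromPairs-upper n _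

    ψ-cong : ∀ {w w'} → (∀ t → w t ≡ w' t) → ψ w ≈F ψ w'
    ψ-cong p = fromPairs-cong n (p ∘ (_↑ˡ m)) , (p ∘ (choose₂ n ↑ʳ_))

    ψ-𝟎 : ψ (λ _ → 0#) ≈F 𝟎F
    ψ-𝟎 = fromPairs-zero n _ (λ _ → refl) , (λ k → refl)

    φ-cong : ∀ {v w} → v ≈F w → ∀ t → φ v t ≡ φ w t
    φ-cong (p , q) t with splitAt (choose₂ n) t
    ... | inj₁ s = p _ _
    ... | inj₂ k = q k

    φ-lc : ∀ {r} (c : Fin r → K) (vs : Fin r → F₂ n m) t → φ (LinF.lc c vs) t ≡ Kᴺ.lc c (φ ∘ vs) t
    φ-lc {zero} c vs t with splitAt (choose₂ n) t
    ... | inj₁ _ = refl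
    ... | inj₂ _ = refl
    φ-lc {suc r} c vs t = trans (φ-⊕· t) (cong (c zero * φ (vs zero) t +_) (φ-lc (c ∘ suc) (vs ∘ suc) t))
      where
      φ-⊕· : ∀ t → φ (LinF.lc c vs) t ≡ c zero * φ (vs zero) t + φ (LinF.lc (c ∘ suc) (vs ∘ suc)) t
      φ-⊕· t with splitAt (choose₂ n) t
      ... | inj₁ _ = refl
      ... | inj₂ _ = refl

-- The dimension formula behind δ₂: if (X₁ , X₂) is a generating o-system of S
-- and ker f₂ has dimension k, then dim S₂ = N - k with N = choose₂ n₁ + n₂ = dim F₂.
module DimensionFormula {𝔽 : FiniteField} (L : G2NLie 𝔽)
                        (≟0 : ∀ (a : FiniteField.K 𝔽) → Dec (a ≡ FiniteField.0# 𝔽))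
                        {S : G2NLieTheory.Pred L} {d : _} (D : G2NLieTheory.IsDelta₂ L S d) where
  open FiniteField 𝔽
  open FieldFacts 𝔽 using (δ)
  open G2NLie L
  open G2NLieTheory L
  open LieFacts L
  open FreeDegreeTwo L
  open Coordinates L
  open IsDelta₂ D
  open OSystem osys
  module Coordinates₂ = Coord n₁ n₂
  open Coordinates₂ public using (N)
  open Coordinates₂ hiding (N)
  open Kᴺ.Steinitz ≟0 using (steinitz)

  private
    X₁∈U₁ : ∀ i → U₁ (X₁ i)
    X₁∈U₁ i = proj₂ (proj₁ basis₁ i)

    X₂∈U₂ : ∀ k → U₂ (X₂ k)
    X₂∈U₂ k = proj₂ (X₂⊆S₂ k)

    ker∈InF₂ : ∀ i → InF₂ (kerBasis i)
    ker∈InF₂ i = proj₁ (proj₁ isKerBasis i)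

    ker↦𝟎 : ∀ i → f₂ X₁ X₂ (kerBasis i) ≡ 𝟎
    ker↦𝟎 i = proj₂ (proj₁ isKerBasis i)

    ker-indep : LinF.LinIndep kerBasis
    ker-indep = proj₁ (proj₂ isKerBasis)

    ker-spans : LinF.Spans (Ker X₁ X₂) kerBasis
    ker-spans = proj₂ (proj₂ isKerBasis)

    preimage : ∀ z → deg₂ S z → ∃ λ v → InF₂ v × z ≡ f₂ X₁ X₂ v
    preimage z (z∈S , z∈U₂) with lift X₁ X₂ X₁∈U₁ X₂∈U₂ (proj₁ (gen z) z∈S)
    ... | _ , (v , v-In , π₂z≡) = v , v-In , trans (sym (U₂-π₂ z z∈U₂)) π₂z≡

    image : ∀ v → deg₂ S (f₂ X₁ X₂ v)
    image v = proj₂ (gen _) (proj₁ (f₂-image X₁ X₂ X₂∈U₂ v)) , proj₂ (f₂-image X₁ X₂ X₂∈U₂ v)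

    module Lifted {r} (g : Fin r → M) (g∈S₂ : ∀ j → deg₂ S (g j)) where
      ĝ : Fin r → F₂ n₁ n₂
      ĝ j = proj₁ (preimage (g j) (g∈S₂ j))

      ĝ∈InF₂ : ∀ j → InF₂ (ĝ j)
      ĝ∈InF₂ j = proj₁ (proj₂ (preimage (g j) (g∈S₂ j)))

      ĝ↦g : ∀ j → g j ≡ f₂ X₁ X₂ (ĝ j)
      ĝ↦g j = proj₂ (proj₂ (preimage (g j) (g∈S₂ j)))

      f₂-lc-ĝ : ∀ c → f₂ X₁ X₂ (LinF.lc c ĝ) ≡ lc c g
      f₂-lc-ĝ c = trans (f₂-lc X₁ X₂ c ĝ) (Lin.lc-cong {c = c} (λ _ → refl) (λ j → sym (ĝ↦g j)))

      fam : Fin (k ℕ.+ r) → F₂ n₁ n₂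
      fam = kerBasis ++ ĝ

      fam∈InF₂ : ∀ t → InF₂ (fam t)
      fam∈InF₂ = ++-induction (λ t → InF₂ (fam t))
        (λ i → subst InF₂ (sym (lookup-++ˡ kerBasis ĝ i)) (ker∈InF₂ i))
        (λ j → subst InF₂ (sym (lookup-++ʳ kerBasis ĝ j)) (ĝ∈InF₂ j))

  -- dim S₂ ≤ N - k: an independent family in S₂, lifted to F₂ and joined to a
  -- basis of ker f₂, stays independent in F₂ ≅ K^N.
  independent-bound : ∀ {r} (h : Fin r → M) → (∀ j → deg₂ S (h j)) → LinIndep h → k ℕ.+ r ℕ.≤ N
  independent-bound {r} h h∈S₂ h-indep = steinitz N (φ ∘ fam) δ fam-indep (λ t → φ (fam t) , λ s → sym (lc-δ-Kⁿ _ s))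
    where
    open Lifted h h∈S₂
    fam-indep : Kᴺ.LinIndep (φ ∘ fam)
    fam-indep c φ-lc≡𝟎 = ++-induction (λ t → c t ≡ 0#) ker-coeffs h-coeffs
      where
      V = LinF.lc c fam
      c₁ = λ i → c (i ↑ˡ r)
      c₂ = λ j → c (k ↑ʳ j)
      V≈𝟎 : V ≈F 𝟎F
      V≈𝟎 = F.≈-trans (F.≈-sym (ψφ V (InF₂-lc c fam fam∈InF₂)))
                      (F.≈-trans (ψ-cong (λ s → trans (φ-lc c fam s) (φ-lc≡𝟎 s))) ψ-𝟎)
      V≈split : V ≈F (LinF.lc c₁ kerBasis ⊕F LinF.lc c₂ ĝ)
      V≈split = F.lc-++ c kerBasis ĝ
      f₂V≡ : f₂ X₁ X₂ V ≡ lc c₂ h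
      f₂V≡ = begin
        f₂ X₁ X₂ V                                              ≡⟨ f₂-cong X₁ X₂ V≈split ⟩
        f₂ X₁ X₂ (LinF.lc c₁ kerBasis ⊕F LinF.lc c₂ ĝ)          ≡⟨ f₂-⊕ X₁ X₂ _ _ ⟩
        f₂ X₁ X₂ (LinF.lc c₁ kerBasis) ⊕ f₂ X₁ X₂ (LinF.lc c₂ ĝ) ≡⟨ cong₂ _⊕_ (f₂-lc X₁ X₂ c₁ kerBasis) (f₂-lc-ĝ c₂) ⟩
        lc c₁ (f₂ X₁ X₂ ∘ kerBasis) ⊕ lc c₂ h                    ≡⟨ cong (_⊕ lc c₂ h) (Lin.lc-zeroʳ c₁ _ ker↦𝟎) ⟩
        𝟎 ⊕ lc c₂ h                                             ≡⟨ AG.identityˡ _ ⟩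
        lc c₂ h ∎
        where open ≡-Reasoning
      h-coeffs : ∀ j → c (k ↑ʳ j) ≡ 0#
      h-coeffs = h-indep c₂ (trans (sym f₂V≡) (trans (f₂-cong X₁ X₂ V≈𝟎) (f₂-𝟎 X₁ X₂)))
      ker-coeffs : ∀ i → c (i ↑ˡ r) ≡ 0#
      ker-coeffs = ker-indep c₁
        (F.≈-trans (F.≈-sym (F.⊕-identityʳ _))
          (F.≈-trans (F.⊕-congˡ _ (F.≈-sym (F.lc-zeroˡ ĝ h-coeffs))) (F.≈-trans (F.≈-sym V≈split) V≈𝟎)))

  -- N - k ≤ dim S₂: if a family g in S₂ spans S₂, then every coordinate vector
  -- of F₂ is a combination of kernel vectors and lifts of g.
  spanning-bound : ∀ {r} (g : Fin r → M) → (∀ j → deg₂ S (g j)) →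
                   (∀ z → S z → U₂ z → DoubleNegation (Lin.InSpan g z)) → DoubleNegation (N ℕ.≤ k ℕ.+ r)
  spanning-bound {r} g g∈S₂ g-spans = bound <$> ¬¬-∀Fin (λ t → g-spans _ (proj₁ (image (ψ (δ t)))) (proj₂ (image (ψ (δ t)))))
    where
    open Lifted g g∈S₂
    δ-in-span : ∀ t → Lin.InSpan g (f₂ X₁ X₂ (ψ (δ t))) → Kᴺ.InSpan (φ ∘ fam) (δ t)
    δ-in-span t (c , f₂v≡) = (ker-coeffs ++ c) , λ s → trans (sym (φψ (δ t) s)) (trans (φ-cong v≈ s) (φ-lc _ fam s))
      where
      v = ψ (δ t)
      w = v ⊕F ((- 1#) ·F LinF.lc c ĝ)
      w∈ker : Ker X₁ X₂ w
      w∈ker = InF₂-⊕ {v = v} {(- 1#) ·F LinF.lc c ĝ} (ψ-InF₂ (δ t)) (InF₂-· (- 1#) {LinF.lc c ĝ} (InF₂-lc c ĝ ĝ∈InF₂)) ,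
              trans (f₂-⊕ X₁ X₂ v _)
                    (trans (cong₂ _⊕_ f₂v≡ (trans (f₂-· X₁ X₂ _ _) (cong ((- 1#) ·_) (f₂-lc-ĝ c))))
                           (Lin.⊖-inverseʳ (lc c g)))
      ker-coeffs = proj₁ (ker-spans w w∈ker)
      v≈ : v ≈F LinF.lc (ker-coeffs ++ c) fam
      v≈ = F.≈-trans (F.≈-sym v≈w+lc)
                     (F.≈-trans (F.⊕-congʳ _ (proj₂ (ker-spans w w∈ker))) (F.≈-sym (F.lc-++-++ ker-coeffs c kerBasis ĝ)))
        where
        v≈w+lc : (w ⊕F LinF.lc c ĝ) ≈F v
        v≈w+lc = F.≈-trans (F.⊕-assoc v _ _)
                   (F.≈-trans (F.⊕-congˡ v (F.≈-trans (F.⊕-comm _ _) (F.⊖-inverseʳ _))) (F.⊕-identityʳ v))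
    bound : (∀ t → Lin.InSpan g (f₂ X₁ X₂ (ψ (δ t)))) → N ℕ.≤ k ℕ.+ r
    bound spans = steinitz (k ℕ.+ r) δ (φ ∘ fam) (λ c lc≡𝟎 i → trans (sym (lc-δ-Kⁿ c i)) (lc≡𝟎 i)) (λ t → δ-in-span t (spans t))

module GeneratedByUnion {𝔽 : FiniteField} (L : G2NLie 𝔽) {A C : G2NLieTheory.Pred L}
                        (A-sub : G2NLieTheory.Substructure L A) (C-sub : G2NLieTheory.Substructure L C) where
  open FiniteField 𝔽
  open G2NLie L
  open G2NLieTheory L
  open LieFacts L
  open ≡-Reasoning
  private
    module SA = Substructure A-sub
    module SC = Substructure C-sub
    module U₁ = IsSubspace U₁-subspace

  A₁+C₁ : Pred
  A₁+C₁ w = Σ M λ a → Σ M λ c → deg₁ A a × deg₁ C c × w ≡ a ⊕ c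

  private
    A₁+C₁-𝟎 : ∀ {w} → w ≡ 𝟎 → A₁+C₁ w
    A₁+C₁-𝟎 w≡𝟎 = 𝟎 , 𝟎 , (SA.∈-𝟎 , U₁.∈-𝟎) , (SC.∈-𝟎 , U₁.∈-𝟎) , trans w≡𝟎 (sym (AG.identityˡ 𝟎))

    A₁+C₁-· : ∀ s {w} → A₁+C₁ w → A₁+C₁ (s · w)
    A₁+C₁-· s (a , c , (a∈A , a∈U₁) , (c∈C , c∈U₁) , w≡) =
      s · a , s · c , (SA.∈-· s a∈A , U₁.∈-· s a∈U₁) , (SC.∈-· s c∈C , U₁.∈-· s c∈U₁) ,
      trans (cong (s ·_) w≡) (·-distribˡ s a c)

  degree-one-part : ∀ {z} → ⟨ A ∪ C ⟩ z → A₁+C₁ (π₁ z)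
  degree-one-part {z} (g-inc (inj₁ z∈A)) = π₁ z , 𝟎 , (SA.∈-π₁ z∈A , π₁-U₁ z) , (SC.∈-𝟎 , U₁.∈-𝟎) , sym (AG.identityʳ _)
  degree-one-part {z} (g-inc (inj₂ z∈C)) = 𝟎 , π₁ z , (SA.∈-𝟎 , U₁.∈-𝟎) , (SC.∈-π₁ z∈C , π₁-U₁ z) , sym (AG.identityˡ _)
  degree-one-part g-𝟎 = A₁+C₁-𝟎 π₁-𝟎
  degree-one-part (g-⊕ {x} {y} p q) with degree-one-part p | degree-one-part q
  ... | (a , c , (a∈A , a∈U₁) , (c∈C , c∈U₁) , e) | (a' , c' , (a'∈A , a'∈U₁) , (c'∈C , c'∈U₁) , e') =
    a ⊕ a' , c ⊕ c' , (SA.∈-⊕ a∈A a'∈A , U₁.∈-⊕ a∈U₁ a'∈U₁) , (SC.∈-⊕ c∈C c'∈C , U₁.∈-⊕ c∈U₁ c'∈U₁) ,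
    trans (π₁-+ x y) (trans (cong₂ _⊕_ e e') (Lin.⊕-interchange a c a' c'))
  degree-one-part (g-· s {x} p) = subst A₁+C₁ (sym (π₁-· s x)) (A₁+C₁-· s (degree-one-part p))
  degree-one-part (g-⊖ {x} p) = subst A₁+C₁ (sym (π₁-⊖ x)) (A₁+C₁-· _ (degree-one-part p))
  degree-one-part (g-π₁ {x} p) = subst A₁+C₁ (sym (π₁∘π₁ x)) (degree-one-part p)
  degree-one-part (g-π₂ {x} p) = A₁+C₁-𝟎 (π₁∘π₂ x)
  degree-one-part (g-⁅⁆ {x} {y} p q) = A₁+C₁-𝟎 (π₁-⁅⁆ x y)

  ⁅⁆-expand : ∀ a c a' c' →
              ⁅ a ⊕ c , a' ⊕ c' ⁆ ≡ (⁅ a , a' ⁆ ⊕ ⁅ a , c' ⁆) ⊕ ((- 1#) · ⁅ a' , c ⁆ ⊕ ⁅ c , c' ⁆)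
  ⁅⁆-expand a c a' c' = begin
    ⁅ a ⊕ c , a' ⊕ c' ⁆                                      ≡⟨ ⁅⁆-+ˡ _ _ _ ⟩
    ⁅ a , a' ⊕ c' ⁆ ⊕ ⁅ c , a' ⊕ c' ⁆                        ≡⟨ cong₂ _⊕_ (⁅⁆-+ʳ _ _ _) (⁅⁆-+ʳ _ _ _) ⟩
    (⁅ a , a' ⁆ ⊕ ⁅ a , c' ⁆) ⊕ (⁅ c , a' ⁆ ⊕ ⁅ c , c' ⁆)    ≡⟨ cong (λ t → (⁅ a , a' ⁆ ⊕ ⁅ a , c' ⁆) ⊕ (t ⊕ ⁅ c , c' ⁆)) (antisym a' c) ⟩
    (⁅ a , a' ⁆ ⊕ ⁅ a , c' ⁆) ⊕ ((- 1#) · ⁅ a' , c ⁆ ⊕ ⁅ c , c' ⁆) ∎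

  module _ (V : Pred) (V-sub : IsSubspace V)
           (A₂⊆V : ∀ {w} → deg₂ A w → V w) (C₂⊆V : ∀ {w} → deg₂ C w → V w)
           (⁅A₁,C₁⁆⊆V : ∀ {a c} → deg₁ A a → deg₁ C c → V ⁅ a , c ⁆) where
    open IsSubspace V-sub

    degree-two-part : ∀ {z} → ⟨ A ∪ C ⟩ z → V (π₂ z)
    degree-two-part {z} (g-inc (inj₁ z∈A)) = A₂⊆V (SA.∈-π₂ z∈A , π₂-U₂ z)
    degree-two-part {z} (g-inc (inj₂ z∈C)) = C₂⊆V (SC.∈-π₂ z∈C , π₂-U₂ z)
    degree-two-part g-𝟎 = subst V (sym π₂-𝟎) ∈-𝟎
    degree-two-part (g-⊕ {x} {y} p q) = subst V (sym (π₂-+ x y)) (∈-⊕ (degree-two-part p) (degree-two-part q))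
    degree-two-part (g-· s {x} p) = subst V (sym (π₂-· s x)) (∈-· s (degree-two-part p))
    degree-two-part (g-⊖ {x} p) = subst V (sym (π₂-⊖ x)) (∈-· _ (degree-two-part p))
    degree-two-part (g-π₁ {x} p) = subst V (sym (π₂∘π₁ x)) ∈-𝟎
    degree-two-part (g-π₂ {x} p) = subst V (sym (π₂∘π₂ x)) (degree-two-part p)
    degree-two-part (g-⁅⁆ {x} {y} p q) with degree-one-part p | degree-one-part q
    ... | (a , c , a∈A₁ , c∈C₁ , e) | (a' , c' , a'∈A₁ , c'∈C₁ , e') =
      subst V (sym π₂⁅x,y⁆≡)
        (∈-⊕ (∈-⊕ (A₂⊆V (SA.∈-⁅⁆ (proj₁ a∈A₁) (proj₁ a'∈A₁) , ⁅⁆-U₂ _ _)) (⁅A₁,C₁⁆⊆V a∈A₁ c'∈C₁))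
             (∈-⊕ (∈-· (- 1#) (⁅A₁,C₁⁆⊆V a'∈A₁ c∈C₁)) (C₂⊆V (SC.∈-⁅⁆ (proj₁ c∈C₁) (proj₁ c'∈C₁) , ⁅⁆-U₂ _ _))))
      where
      π₂⁅x,y⁆≡ : π₂ ⁅ x , y ⁆ ≡ (⁅ a , a' ⁆ ⊕ ⁅ a , c' ⁆) ⊕ ((- 1#) · ⁅ a' , c ⁆ ⊕ ⁅ c , c' ⁆)
      π₂⁅x,y⁆≡ = trans (π₂-⁅⁆ x y) (trans (cong₂ ⁅_,_⁆ e e') (⁅⁆-expand a c a' c'))

module Counting where
  open import Data.Integer using (+_; +≤+)

  choose₂-+ : ∀ a b → choose₂ (a ℕ.+ b) ≡ choose₂ a ℕ.+ choose₂ b ℕ.+ a ℕ.* b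
  choose₂-+ zero b = sym (ℕ.+-identityʳ (choose₂ b))
  choose₂-+ (suc a) b = trans (cong ((a ℕ.+ b) ℕ.+_) (choose₂-+ a b)) (regroup a b (choose₂ a) (choose₂ b))
    where
    regroup : ∀ a b ta tb → (a ℕ.+ b) ℕ.+ (ta ℕ.+ tb ℕ.+ a ℕ.* b) ≡ (a ℕ.+ ta) ℕ.+ tb ℕ.+ suc a ℕ.* b
    regroup = ℕ-Solver.solve-∀

  -- Inclusion–exclusion for choose₂ fails by exactly p q, the number of brackets
  -- between the p new generators of A and the q new generators of C.
  choose₂-inclusion-exclusion : ∀ i p q → choose₂ (i ℕ.+ (p ℕ.+ q)) ℕ.+ choose₂ i ≡ choose₂ (i ℕ.+ p) ℕ.+ choose₂ (i ℕ.+ q) ℕ.+ p ℕ.* q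
  choose₂-inclusion-exclusion i p q =
    trans (cong (ℕ._+ choose₂ i) (trans (choose₂-+ i (p ℕ.+ q)) (cong (λ t → choose₂ i ℕ.+ t ℕ.+ i ℕ.* (p ℕ.+ q)) (choose₂-+ p q))))
          (trans (regroup (choose₂ i) (choose₂ p) (choose₂ q) i p q)
                 (sym (cong₂ (λ s t → s ℕ.+ t ℕ.+ p ℕ.* q) (choose₂-+ i p) (choose₂-+ i q))))
    where
    regroup : ∀ ti tp tq i p q →
              ti ℕ.+ (tp ℕ.+ tq ℕ.+ p ℕ.* q) ℕ.+ i ℕ.* (p ℕ.+ q) ℕ.+ ti
              ≡ (ti ℕ.+ tp ℕ.+ i ℕ.* p) ℕ.+ (ti ℕ.+ tq ℕ.+ i ℕ.* q) ℕ.+ p ℕ.* q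
    regroup = ℕ-Solver.solve-∀

  degree-one-count : ∀ i p q → (i ℕ.+ (p ℕ.+ q)) ℕ.+ i ≡ (i ℕ.+ p) ℕ.+ (i ℕ.+ q)
  degree-one-count = ℕ-Solver.solve-∀

  -- The four dimension bounds in degree 2 add up to the degree-2 part of the
  -- inequality; the choose₂-terms cancel by inclusion–exclusion.
  degree-two-count : ∀ i p q u₂ a₂ c₂ i₂ kU kA kC kI β α γ →
    choose₂ (i ℕ.+ (p ℕ.+ q)) ℕ.+ u₂ ℕ.≤ kU ℕ.+ (β ℕ.+ (α ℕ.+ (γ ℕ.+ p ℕ.* q))) →
    choose₂ i ℕ.+ i₂ ℕ.≤ kI ℕ.+ β →
    kA ℕ.+ (β ℕ.+ α) ℕ.≤ choose₂ (i ℕ.+ p) ℕ.+ a₂ →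
    kC ℕ.+ (β ℕ.+ γ) ℕ.≤ choose₂ (i ℕ.+ q) ℕ.+ c₂ →
    u₂ ℕ.+ i₂ ℕ.+ kA ℕ.+ kC ℕ.≤ a₂ ℕ.+ c₂ ℕ.+ kU ℕ.+ kI
  degree-two-count i p q u₂ a₂ c₂ i₂ kU kA kC kI β α γ hU hI hA hC =
    ℕ.+-cancelʳ-≤ common _ _ (subst₂ ℕ._≤_ lhs≡ rhs≡ (ℕ.+-mono-≤ (ℕ.+-mono-≤ (ℕ.+-mono-≤ hU hI) hA) hC))
    where
    tU = choose₂ (i ℕ.+ (p ℕ.+ q)) ; tA = choose₂ (i ℕ.+ p) ; tC = choose₂ (i ℕ.+ q) ; tI = choose₂ i
    common = tA ℕ.+ tC ℕ.+ p ℕ.* q ℕ.+ β ℕ.+ β ℕ.+ α ℕ.+ γ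
    lhs≡ : (tU ℕ.+ u₂) ℕ.+ (tI ℕ.+ i₂) ℕ.+ (kA ℕ.+ (β ℕ.+ α)) ℕ.+ (kC ℕ.+ (β ℕ.+ γ))
           ≡ (u₂ ℕ.+ i₂ ℕ.+ kA ℕ.+ kC) ℕ.+ common
    lhs≡ = trans (regroup tU tI u₂ i₂ kA kC β α γ)
                 (cong (λ t → (u₂ ℕ.+ i₂ ℕ.+ kA ℕ.+ kC) ℕ.+ (t ℕ.+ β ℕ.+ β ℕ.+ α ℕ.+ γ)) (choose₂-inclusion-exclusion i p q))
      where
      regroup : ∀ tU tI u₂ i₂ kA kC β α γ →
                (tU ℕ.+ u₂) ℕ.+ (tI ℕ.+ i₂) ℕ.+ (kA ℕ.+ (β ℕ.+ α)) ℕ.+ (kC ℕ.+ (β ℕ.+ γ))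
                ≡ (u₂ ℕ.+ i₂ ℕ.+ kA ℕ.+ kC) ℕ.+ (tU ℕ.+ tI ℕ.+ β ℕ.+ β ℕ.+ α ℕ.+ γ)
      regroup = ℕ-Solver.solve-∀
    rhs≡ : (kU ℕ.+ (β ℕ.+ (α ℕ.+ (γ ℕ.+ p ℕ.* q)))) ℕ.+ (kI ℕ.+ β) ℕ.+ (tA ℕ.+ a₂) ℕ.+ (tC ℕ.+ c₂)
           ≡ (a₂ ℕ.+ c₂ ℕ.+ kU ℕ.+ kI) ℕ.+ common
    rhs≡ = regroup tA tC (p ℕ.* q) a₂ c₂ kU kI β α γ
      where
      regroup : ∀ tA tC pq a₂ c₂ kU kI β α γ →
                (kU ℕ.+ (β ℕ.+ (α ℕ.+ (γ ℕ.+ pq)))) ℕ.+ (kI ℕ.+ β) ℕ.+ (tA ℕ.+ a₂) ℕ.+ (tC ℕ.+ c₂)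
                ≡ (a₂ ℕ.+ c₂ ℕ.+ kU ℕ.+ kI) ℕ.+ (tA ℕ.+ tC ℕ.+ pq ℕ.+ β ℕ.+ β ℕ.+ α ℕ.+ γ)
      regroup = ℕ-Solver.solve-∀

  δ₂-value : ℕ → ℕ → ℕ → ℤ
  δ₂-value n₁ n₂ k = (+ n₁ ℤ.+ + n₂) ℤ.- + k

  δ-submodular : ∀ u₁ u₂ kU a₁ a₂ kA c₁ c₂ kC i₁ i₂ kI →
    u₁ ℕ.+ i₁ ≡ a₁ ℕ.+ c₁ →
    u₂ ℕ.+ i₂ ℕ.+ kA ℕ.+ kC ℕ.≤ a₂ ℕ.+ c₂ ℕ.+ kU ℕ.+ kI →
    δ₂-value u₁ u₂ kU ℤ.≤ δ₂-value a₁ a₂ kA ℤ.+ δ₂-value c₁ c₂ kC ℤ.- δ₂-value i₁ i₂ kI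
  δ-submodular u₁ u₂ kU a₁ a₂ kA c₁ c₂ kC i₁ i₂ kI deg₁ deg₂ =
    ℤ.0≤i-j⇒j≤i (subst (ℤ._≤_ (+ 0)) (sym difference) (ℤ.i≤j⇒0≤j-i (+≤+ deg₂)))
    where
    pos-+₄ : ∀ a b c d → + (a ℕ.+ b ℕ.+ c ℕ.+ d) ≡ + a ℤ.+ + b ℤ.+ + c ℤ.+ + d
    pos-+₄ a b c d = trans (ℤ.pos-+ (a ℕ.+ b ℕ.+ c) d) (cong (ℤ._+ + d) (trans (ℤ.pos-+ (a ℕ.+ b) c) (cong (ℤ._+ + c) (ℤ.pos-+ a b))))
    regroup : ∀ U₁ U₂ KU A₁ A₂ KA C₁ C₂ KC I₁ I₂ KI →
      ((((A₁ ℤ.+ A₂) ℤ.- KA) ℤ.+ ((C₁ ℤ.+ C₂) ℤ.- KC)) ℤ.- ((I₁ ℤ.+ I₂) ℤ.- KI)) ℤ.- ((U₁ ℤ.+ U₂) ℤ.- KU)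
      ≡ ((A₂ ℤ.+ C₂ ℤ.+ KU ℤ.+ KI) ℤ.- (U₂ ℤ.+ I₂ ℤ.+ KA ℤ.+ KC)) ℤ.+ ((A₁ ℤ.+ C₁) ℤ.- (U₁ ℤ.+ I₁))
    regroup = ℤ-Solver.solve-∀
    degree-one-cancels : (+ a₁ ℤ.+ + c₁) ℤ.- (+ u₁ ℤ.+ + i₁) ≡ + 0
    degree-one-cancels = trans (cong (λ t → (+ a₁ ℤ.+ + c₁) ℤ.- t) (trans (sym (ℤ.pos-+ u₁ i₁)) (trans (cong +_ deg₁) (ℤ.pos-+ a₁ c₁))))
                               (ℤ.+-inverseʳ (+ a₁ ℤ.+ + c₁))
    difference : (δ₂-value a₁ a₂ kA ℤ.+ δ₂-value c₁ c₂ kC ℤ.- δ₂-value i₁ i₂ kI) ℤ.- δ₂-value u₁ u₂ kU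
                 ≡ + (a₂ ℕ.+ c₂ ℕ.+ kU ℕ.+ kI) ℤ.- + (u₂ ℕ.+ i₂ ℕ.+ kA ℕ.+ kC)
    difference = trans (regroup (+ u₁) (+ u₂) (+ kU) (+ a₁) (+ a₂) (+ kA) (+ c₁) (+ c₂) (+ kC) (+ i₁) (+ i₂) (+ kI))
                 (trans (cong (λ t → (+ a₂ ℤ.+ + c₂ ℤ.+ + kU ℤ.+ + kI) ℤ.- (+ u₂ ℤ.+ + i₂ ℤ.+ + kA ℤ.+ + kC) ℤ.+ t) degree-one-cancels)
                 (trans (ℤ.+-identityʳ _) (sym (cong₂ ℤ._-_ (pos-+₄ a₂ c₂ kU kI) (pos-+₄ u₂ i₂ kA kC)))))

open Counting

module Submodularity {𝔽 : FiniteField} (L : G2NLie 𝔽)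
    (≟0 : ∀ (a : FiniteField.K 𝔽) → Dec (a ≡ FiniteField.0# 𝔽))
    {A C : G2NLieTheory.Pred L} (A-sub : G2NLieTheory.Substructure L A) (C-sub : G2NLieTheory.Substructure L C)
    {dU dA dC dI : ℤ}
    (DU : G2NLieTheory.IsDelta₂ L (G2NLieTheory.⟨_⟩ L (G2NLieTheory._∪_ L A C)) dU)
    (DA : G2NLieTheory.IsDelta₂ L A dA) (DC : G2NLieTheory.IsDelta₂ L C dC)
    (DI : G2NLieTheory.IsDelta₂ L (G2NLieTheory._∩_ L A C) dI) where
  open FiniteField 𝔽
  open G2NLie L
  open G2NLieTheory L
  open LieFacts L
  open GeneratedByUnion L A-sub C-sub
  open BasisExtension vectorSpace ≟0
  open Lin.Steinitz ≟0 using (steinitz; basis-length)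
  open Completion
  open ≡-Reasoning
  private
    module SA = Substructure A-sub
    module SC = Substructure C-sub
    module DimU = DimensionFormula L ≟0 DU
    module DimA = DimensionFormula L ≟0 DA
    module DimC = DimensionFormula L ≟0 DC
    module DimI = DimensionFormula L ≟0 DI

  I U : Pred
  I = A ∩ C
  U = ⟨ A ∪ C ⟩

  basis₁ : ∀ {S d} (D : IsDelta₂ S d) → IsBasis (deg₁ S) (IsDelta₂.X₁ D)
  basis₁ D = OSystem.basis₁ (IsDelta₂.osys D)

  i : ℕ
  i = IsDelta₂.n₁ DI

  XI : Fin i → M
  XI = IsDelta₂.X₁ DI

  I⊆A : ∀ {G : Pred} {w} → I w × G w → A w × G w
  I⊆A ((w∈A , _) , w∈G) = w∈A , w∈G

  I⊆C : ∀ {G : Pred} {w} → I w × G w → C w × G w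
  I⊆C ((_ , w∈C) , w∈G) = w∈C , w∈G

  XI∈A₁ : ∀ j → deg₁ A (XI j)
  XI∈A₁ j = I⊆A {U₁} (proj₁ (basis₁ DI) j)

  XI∈C₁ : ∀ j → deg₁ C (XI j)
  XI∈C₁ j = I⊆C {U₁} (proj₁ (basis₁ DI) j)

  basis-bound : ∀ {S d} (D : IsDelta₂ S d) {r} (h : Fin r → M) → (∀ j → deg₁ S (h j)) → LinIndep h →
                r ℕ.≤ IsDelta₂.n₁ D
  basis-bound D h h∈S₁ h-indep =
    steinitz _ h (IsDelta₂.X₁ D) h-indep (λ j → proj₂ (proj₂ (basis₁ D)) (h j) (h∈S₁ j))

  N-bound : ∀ {S d} (D : IsDelta₂ S d) {r} (h : Fin r → M) → (∀ j → deg₂ S (h j)) → LinIndep h →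
            r ℕ.≤ DimensionFormula.N L ≟0 D
  N-bound D {r} h h∈S₂ h-indep =
    ℕ.≤-trans (ℕ.m≤n+m r _) (DimensionFormula.independent-bound L ≟0 D h h∈S₂ h-indep)

  joint-span-∈ : ∀ {V} → IsSubspace V → ∀ {n m} {x : Fin n → M} {y : Fin m → M} →
                 (∀ j → V (x j)) → (∀ j → V (y j)) → ∀ {w} → InJointSpan x y w → V w
  joint-span-∈ {V} V-sub {x = x} {y} x∈V y∈V (c , d , w≡) = subst V (sym w≡) (∈-⊕ (∈-lc c x x∈V) (∈-lc d y y∈V))
    where open IsSubspace V-sub

  module DegreeOne (CP : Completion (deg₁ A) XI) (CQ : Completion (deg₁ C) XI) where
    p q : ℕ
    p = len CP
    q = len CQ

    P : Fin p → M
    P = family CP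

    Q : Fin q → M
    Q = family CQ

    dimA₁ : IsDelta₂.n₁ DA ≡ i ℕ.+ p
    dimA₁ = basis-length (XI ++ P) (basis₁ DA) (++-all (deg₁ A) XI∈A₁ (inP CP))
              (jointly⇒independent XI P (indep CP)) (λ w w∈A₁ → joint⇒span XI P w <$> spans CP w w∈A₁)

    dimC₁ : IsDelta₂.n₁ DC ≡ i ℕ.+ q
    dimC₁ = basis-length (XI ++ Q) (basis₁ DC) (++-all (deg₁ C) XI∈C₁ (inP CQ))
              (jointly⇒independent XI Q (indep CQ)) (λ w w∈C₁ → joint⇒span XI Q w <$> spans CQ w w∈C₁)

    Y : Fin (i ℕ.+ (p ℕ.+ q)) → M
    Y = XI ++ (P ++ Q)

    Y∈U₁ : ∀ t → deg₁ U (Y t)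
    Y∈U₁ = ++-all (deg₁ U) (λ j → g-inc (inj₁ (proj₁ (XI∈A₁ j))) , proj₂ (XI∈A₁ j))
             (++-all (deg₁ U) (λ j → g-inc (inj₁ (proj₁ (inP CP j))) , proj₂ (inP CP j))
                              (λ j → g-inc (inj₂ (proj₁ (inP CQ j))) , proj₂ (inP CQ j)))

    -- A₁ ∩ C₁ = I₁ is spanned by XI, so P and Q add independent directions.
    Y-indep : LinIndep Y
    Y-indep = jointly⇒independent XI (P ++ Q) joint
      where
      joint : JointlyIndependent XI (P ++ Q)
      joint e d eq = proj₁ XI,P-zero , ++-induction (λ t → d t ≡ 0#) (proj₂ XI,P-zero) Q-zero
        where
        d₁ = λ j → d (j ↑ˡ q)
        d₂ = λ j → d (p ↑ʳ j)
        a = lc e XI ⊕ lc d₁ P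
        w = lc d₂ Q
        a⊕w≡𝟎 : a ⊕ w ≡ 𝟎
        a⊕w≡𝟎 = trans (AG.assoc _ _ _) (trans (cong (lc e XI ⊕_) (sym (Lin.lc-++ d P Q))) eq)
        w∈I₁ : deg₁ I w
        w∈I₁ = (subst A (sym (Lin.⊕≈𝟎⇒≈⊖ w a (trans (AG.comm w a) a⊕w≡𝟎)))
                      (SA.∈-· _ (SA.∈-⊕ (∈-lc e XI (proj₁ ∘ XI∈A₁)) (∈-lc d₁ P (proj₁ ∘ inP CP)))) ,
                ∈-lc′ d₂ Q (proj₁ ∘ inP CQ)) ,
               IsSubspace.∈-lc U₁-subspace d₂ Q (proj₂ ∘ inP CQ)
          where open IsSubspace (substructure⇒subspace A-sub) using (∈-lc)
                open IsSubspace (substructure⇒subspace C-sub) using () renaming (∈-lc to ∈-lc′)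
        f = proj₁ (proj₂ (proj₂ (basis₁ DI)) w w∈I₁)
        w≡ : w ≡ lc f XI
        w≡ = proj₂ (proj₂ (proj₂ (basis₁ DI)) w w∈I₁)
        Q-zero : ∀ j → d (p ↑ʳ j) ≡ 0#
        Q-zero = proj₂ (indep CQ (λ j → (- 1#) * f j) d₂ (begin
          lc (λ j → (- 1#) * f j) XI ⊕ w   ≡⟨ cong (_⊕ w) (trans (Lin.lc-* (- 1#) f XI) (cong ((- 1#) ·_) (sym w≡))) ⟩
          (- 1#) · w ⊕ w                   ≡⟨ AG.comm _ _ ⟩
          w ⊕ (- 1#) · w                   ≡⟨ Lin.⊖-inverseʳ w ⟩
          𝟎 ∎))
        XI,P-zero = indep CP e d₁ (trans (sym (AG.identityʳ a)) (trans (cong (a ⊕_) (sym (Lin.lc-zeroˡ Q Q-zero))) a⊕w≡𝟎))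

    Y-spans : ∀ w → deg₁ U w → DoubleNegation (Lin.InSpan Y w)
    Y-spans w (w∈U , w∈U₁) with degree-one-part w∈U
    ... | a , c , a∈A₁ , c∈C₁ , π₁w≡ = subst (¬¬Span Y) (trans (sym π₁w≡) (U₁-π₁ w w∈U₁)) (∈-⊕ a∈V c∈V)
      where
      open IsSubspace (¬¬Span-subspace Y)
      Y∈V = ¬¬Span-∋ Y
      XI∈V = ++-allˡ (¬¬Span Y) XI (P ++ Q) Y∈V
      P∈V = ++-allˡ (¬¬Span Y) P Q (++-allʳ (¬¬Span Y) XI (P ++ Q) Y∈V)
      Q∈V = ++-allʳ (¬¬Span Y) P Q (++-allʳ (¬¬Span Y) XI (P ++ Q) Y∈V)
      a∈V = spans CP a a∈A₁ >>= joint-span-∈ (¬¬Span-subspace Y) XI∈V P∈V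
      c∈V = spans CQ c c∈C₁ >>= joint-span-∈ (¬¬Span-subspace Y) XI∈V Q∈V

    dimU₁ : IsDelta₂.n₁ DU ≡ i ℕ.+ (p ℕ.+ q)
    dimU₁ = basis-length Y (basis₁ DU) Y∈U₁ Y-indep Y-spans

    module DegreeTwo (Cb : Completion (deg₂ I) {0} (λ ()))
                     (Cas : Completion (deg₂ A) (family Cb)) (Ccs : Completion (deg₂ C) (family Cb)) where
      β α γ : ℕ
      β = len Cb
      α = len Cas
      γ = len Ccs

      b : Fin β → M
      b = family Cb

      as : Fin α → M
      as = family Cas

      cs : Fin γ → M
      cs = family Ccs

      b∈A₂ : ∀ j → deg₂ A (b j)
      b∈A₂ j = I⊆A {U₂} (inP Cb j)

      b∈C₂ : ∀ j → deg₂ C (b j)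
      b∈C₂ j = I⊆C {U₂} (inP Cb j)

      brackets : Fin (p ℕ.* q) → M
      brackets t = uncurry (λ i j → ⁅ P i , Q j ⁆) (remQuot q t)

      brackets-combine : ∀ i j → brackets (combine i j) ≡ ⁅ P i , Q j ⁆
      brackets-combine i j = cong (uncurry (λ i j → ⁅ P i , Q j ⁆)) (remQuot-combine i j)

      g : Fin (β ℕ.+ (α ℕ.+ (γ ℕ.+ p ℕ.* q))) → M
      g = b ++ (as ++ (cs ++ brackets))

      g∈U₂ : ∀ t → deg₂ U (g t)
      g∈U₂ = ++-all (deg₂ U) (λ j → g-inc (inj₁ (proj₁ (b∈A₂ j))) , proj₂ (b∈A₂ j))
               (++-all (deg₂ U) (λ j → g-inc (inj₁ (proj₁ (inP Cas j))) , proj₂ (inP Cas j))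
                 (++-all (deg₂ U) (λ j → g-inc (inj₂ (proj₁ (inP Ccs j))) , proj₂ (inP Ccs j))
                   (λ t → g-⁅⁆ (g-inc (inj₁ (proj₁ (inP CP _)))) (g-inc (inj₂ (proj₁ (inP CQ _)))) , ⁅⁆-U₂ _ _)))

      bracket-split : ∀ {a c} e f e' f' → a ≡ lc e XI ⊕ lc f P → c ≡ lc e' XI ⊕ lc f' Q →
                      ⁅ a , c ⁆ ≡ ⁅ a , lc e' XI ⁆ ⊕ (⁅ lc e XI , lc f' Q ⁆ ⊕ ⁅ lc f P , lc f' Q ⁆)
      bracket-split {a} {c} e f e' f' a≡ c≡ = begin
        ⁅ a , c ⁆                                       ≡⟨ cong ⁅ a ,_⁆ c≡ ⟩
        ⁅ a , lc e' XI ⊕ lc f' Q ⁆                      ≡⟨ ⁅⁆-+ʳ _ _ _ ⟩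
        ⁅ a , lc e' XI ⁆ ⊕ ⁅ a , lc f' Q ⁆              ≡⟨ cong (λ t → ⁅ a , lc e' XI ⁆ ⊕ ⁅ t , lc f' Q ⁆) a≡ ⟩
        ⁅ a , lc e' XI ⁆ ⊕ ⁅ lc e XI ⊕ lc f P , lc f' Q ⁆ ≡⟨ cong (⁅ a , lc e' XI ⁆ ⊕_) (⁅⁆-+ˡ _ _ _) ⟩
        ⁅ a , lc e' XI ⁆ ⊕ (⁅ lc e XI , lc f' Q ⁆ ⊕ ⁅ lc f P , lc f' Q ⁆) ∎

      g-spans : ∀ z → U z → U₂ z → DoubleNegation (Lin.InSpan g z)
      g-spans z z∈U z∈U₂ = subst V (U₂-π₂ z z∈U₂) (degree-two-part V V-sub A₂⊆V C₂⊆V ⁅A₁,C₁⁆⊆V z∈U)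
        where
        V = ¬¬Span g
        V-sub = ¬¬Span-subspace g
        open IsSubspace V-sub
        g∈V = ¬¬Span-∋ g
        b∈V = ++-allˡ V b _ g∈V
        as∈V = ++-allˡ V as _ (++-allʳ V b _ g∈V)
        cs∈V = ++-allˡ V cs _ (++-allʳ V as _ (++-allʳ V b _ g∈V))
        ⁅P,Q⁆∈V : ∀ i j → V ⁅ P i , Q j ⁆
        ⁅P,Q⁆∈V i j = subst V (brackets-combine i j) (++-allʳ V cs _ (++-allʳ V as _ (++-allʳ V b _ g∈V)) (combine i j))
        A₂⊆V : ∀ {w} → deg₂ A w → V w
        A₂⊆V {w} w∈A₂ = spans Cas w w∈A₂ >>= joint-span-∈ V-sub b∈V as∈V
        C₂⊆V : ∀ {w} → deg₂ C w → V w
        C₂⊆V {w} w∈C₂ = spans Ccs w w∈C₂ >>= joint-span-∈ V-sub b∈V cs∈V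
        ⁅A₁,C₁⁆⊆V : ∀ {a c} → deg₁ A a → deg₁ C c → V ⁅ a , c ⁆
        ⁅A₁,C₁⁆⊆V {a} {c} a∈A₁ c∈C₁ = do
          (e , f , a≡) ← spans CP a a∈A₁
          (e' , f' , c≡) ← spans CQ c c∈C₁
          subst V (sym (bracket-split e f e' f' a≡ c≡))
            (∈-⊕ (A₂⊆V (SA.∈-⁅⁆ (proj₁ a∈A₁) (∈-lcᴬ e' XI (proj₁ ∘ XI∈A₁)) , ⁅⁆-U₂ _ _))
                 (∈-⊕ (C₂⊆V (SC.∈-⁅⁆ (∈-lcᶜ e XI (proj₁ ∘ XI∈C₁)) (∈-lcᶜ f' Q (proj₁ ∘ inP CQ)) , ⁅⁆-U₂ _ _))
                      (⁅lc,lc⁆-∈ V-sub f P f' Q ⁅P,Q⁆∈V)))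
          where
          open IsSubspace (substructure⇒subspace A-sub) using () renaming (∈-lc to ∈-lcᴬ)
          open IsSubspace (substructure⇒subspace C-sub) using () renaming (∈-lc to ∈-lcᶜ)

      bound-I : DimI.N ℕ.≤ IsDelta₂.k DI ℕ.+ β
      bound-I = decidable-stable (_ ℕ.≤? _) (DimI.spanning-bound b (inP Cb) b-spans)
        where
        b-spans : ∀ z → I z → U₂ z → DoubleNegation (Lin.InSpan b z)
        b-spans z z∈I z∈U₂ = (λ { (_ , d , z≡) → d , trans z≡ (AG.identityˡ _) }) <$> spans Cb z (z∈I , z∈U₂)

      bound-A : IsDelta₂.k DA ℕ.+ (β ℕ.+ α) ℕ.≤ DimA.N
      bound-A = DimA.independent-bound (b ++ as) (++-all (deg₂ A) b∈A₂ (inP Cas)) (jointly⇒independent b as (indep Cas))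

      bound-C : IsDelta₂.k DC ℕ.+ (β ℕ.+ γ) ℕ.≤ DimC.N
      bound-C = DimC.independent-bound (b ++ cs) (++-all (deg₂ C) b∈C₂ (inP Ccs)) (jointly⇒independent b cs (indep Ccs))

      bound-U : DimU.N ℕ.≤ IsDelta₂.k DU ℕ.+ (β ℕ.+ (α ℕ.+ (γ ℕ.+ p ℕ.* q)))
      bound-U = decidable-stable (_ ℕ.≤? _) (DimU.spanning-bound g g∈U₂ g-spans)

      submodular : dU ℤ.≤ dA ℤ.+ dC ℤ.- dI
      submodular =
        subst₂ ℤ._≤_ (sym (value DU)) (sym (cong₂ ℤ._-_ (cong₂ ℤ._+_ (value DA) (value DC)) (value DI)))
          (δ-submodular (n₁ DU) u₂ kU (n₁ DA) a₂ kA (n₁ DC) c₂ kC i i₂ kI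
            (trans (cong (ℕ._+ i) dimU₁) (trans (degree-one-count i p q) (sym (cong₂ ℕ._+_ dimA₁ dimC₁))))
            (degree-two-count i p q u₂ a₂ c₂ i₂ kU kA kC kI β α γ
              (subst (λ n → choose₂ n ℕ.+ u₂ ℕ.≤ kU ℕ.+ (β ℕ.+ (α ℕ.+ (γ ℕ.+ p ℕ.* q)))) dimU₁ bound-U) bound-I
              (subst (λ n → kA ℕ.+ (β ℕ.+ α) ℕ.≤ choose₂ n ℕ.+ a₂) dimA₁ bound-A)
              (subst (λ n → kC ℕ.+ (β ℕ.+ γ) ℕ.≤ choose₂ n ℕ.+ c₂) dimC₁ bound-C)))
        where
        open IsDelta₂ using (n₁; n₂; k; value)
        u₂ = n₂ DU ; a₂ = n₂ DA ; c₂ = n₂ DC ; i₂ = n₂ DI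
        kU = k DU ; kA = k DA ; kC = k DC ; kI = k DI

  inequality : DoubleNegation (dU ℤ.≤ dA ℤ.+ dC ℤ.- dI)
  inequality = do
    CP ← extend-to-basis (deg₁ A) _ (basis-bound DA) XI XI∈A₁ XI-indep
    CQ ← extend-to-basis (deg₁ C) _ (basis-bound DC) XI XI∈C₁ XI-indep
    Cb ← extend-to-basis (deg₂ I) _ (N-bound DI) (λ ()) (λ ()) (λ _ _ ())
    Cas ← extend-to-basis (deg₂ A) _ (N-bound DA) (family Cb) (λ j → I⊆A {U₂} (inP Cb j)) (b-indep Cb)
    Ccs ← extend-to-basis (deg₂ C) _ (N-bound DC) (family Cb) (λ j → I⊆C {U₂} (inP Cb j)) (b-indep Cb)
    pure (DegreeOne.DegreeTwo.submodular CP CQ Cb Cas Ccs)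
    where
    XI-indep : LinIndep XI
    XI-indep = proj₁ (proj₂ (basis₁ DI))
    b-indep : (Cb : Completion (deg₂ I) {0} (λ ())) → LinIndep (family Cb)
    b-indep Cb c eq = proj₂ (indep Cb (λ ()) c (trans (AG.identityˡ _) eq))

open import Data.Integer using (ℤ; _+_; _-_; _≤_)

lemma2p9 : (𝔽 : FiniteField) (L : G2NLie 𝔽) →
    let open G2NLieTheory L in
    (A C : Pred) →
    Substructure A → FinitePred A →
    Substructure C → FinitePred C →
    (dAC dA dC dI : ℤ) →
    IsDelta₂ ⟨ A ∪ C ⟩ dAC → IsDelta₂ A dA → IsDelta₂ C dC → IsDelta₂ (A ∩ C) dI →
    dAC ≤ dA + dC - dI
lemma2p9 𝔽 L A C A-sub _ C-sub _ dAC dA dC dI DAC DA DC DI = decidable-stable (_ ℤ.≤? _) (do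
  ≟0 ← ¬¬-∀Listed elements complete (λ _ → ¬¬-excluded-middle)
  Submodularity.inequality L ≟0 A-sub C-sub DAC DA DC DI)
  where open FiniteField 𝔽 using (elements; complete)
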